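{- Let $W$ be one of $S_n$ ($n\ge1$), $S^B_n$ ($n\ge1$), $\widetilde{S}_n$ ($n\ge3$), $\widetilde{S}^C_n$ ($n\ge2$), with window size $n$. If $w\in W$ has a reduced word containing a consecutive triple of letters $x\,(x+1)\,x$ or $x\,(x-1)\,x$ for some $x\in[n-1]$, then $\mathrm{dis}(w)/2<\ell_S(w)$.
   Context: - $S_n$: permutations of $[n]$. - $S^B_n$: bijections $w$ of $\{ -n,\dots,n\}$ with $w(-i)=-w(i)$. - $\widetilde{S}_n$: bijections $w$ of $\mathbb{Z}$ with $w(i+n)=w(i)+n$ and $\sum_{i=1}^n w(i)=\binom{n+1}{2}$. - $\widetilde{S}^C_n$: bijections $w$ of $\mathbb{Z}$ with $w(-i)=-w(i)$ and $w(2(n+1)-i)=2(n+1)-w(i)$. Generators (each transposition extended by the group's symmetries): $s_i$ swaps $i,i+1$ for $1\le i\le n-1$; in $\widetilde{S}_n$, $s_0=s_n$ swaps $0,1$ (letters $0$ and $n$ denote the same generator); in $S^B_n$ and $\widetilde{S}^C_n$, $s_0$ swaps $-1,1$; in $\widetilde{S}^C_n$, $s_n$ swaps $n,n+2$. $\ell_S(w)$ is the Coxeter length with respect to these generators; a reduced word for $w$ is a word $i_1\cdots i_\ell$ with $w=s_{i_1}\cdots s_{i_\ell}$ and $\ell=\ell_S(w)$. $\mathrm{dis}(w)=\sum_{i=1}^n|w(i)-i|$. -}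

module Defs where

open import Data.Bool using (Bool; true; false; if_then_else_)
open import Data.Nat as ℕ using (ℕ; zero; suc; _≤_; _<_; _≡ᵇ_)
open import Data.Integer as ℤ using (ℤ; +_; _%ℕ_; ∣_∣)
open import Data.List using (List; []; _∷_; _++_; length)
open import Data.List.Relation.Unary.All using (All)
open import Data.Product using (Σ; ∃; _×_)
open import Data.Sum using (_⊎_)
open import Relation.Binary.PropositionalEquality using (_≡_)
open import Relation.Nullary.Decidable using (⌊_⌋)

-- The four groups.  Every element is regarded as a bijection ℤ → ℤ
-- (for S_n and S^B_n, extended by the identity outside [n], resp.
-- outside {-n,…,n}; this does not affect equality of elements).

data GroupType : Set where
  typeA  : GroupType
  typeB  : GroupType
  typeÃ  : GroupType
  typeC̃  : GroupType

minRank : GroupType → ℕ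
minRank typeA = 1
minRank typeB = 1
minRank typeÃ = 3
minRank typeC̃ = 2

swapZ : ℤ → ℤ → ℤ → ℤ
swapZ a b j = if ⌊ j ℤ.≟ a ⌋ then b else if ⌊ j ℤ.≟ b ⌋ then a else j

-- residue of j modulo M (M = 0 is never used in the theorem)
residue : ℕ → ℤ → ℕ
residue zero    j = ∣ j ∣
residue (suc m) j = j %ℕ suc m

≡mod : ℕ → ℤ → ℤ → Bool
≡mod M a b = residue M a ≡ᵇ residue M b

swapMod : ℕ → ℤ → ℤ → ℤ → ℤ
swapMod M a d j =
  if ≡mod M j a then j ℤ.+ d
  else if ≡mod M j (a ℤ.+ d) then j ℤ.- d
  else j

gen : GroupType → ℕ → ℕ → ℤ → ℤ
gen typeA n i = swapZ (+ i) (+ suc i)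
gen typeB n zero = swapZ (ℤ.- (+ 1)) (+ 1)
gen typeB n (suc k) j =
  swapZ (+ suc k) (+ suc (suc k)) (swapZ (ℤ.- (+ suc k)) (ℤ.- (+ suc (suc k))) j)
gen typeÃ n i = swapMod n (+ i) (+ 1)
gen typeC̃ n i j =
  if i ≡ᵇ 0 then swapMod N (ℤ.- (+ 1)) (+ 2) j
  else if i ≡ᵇ n then swapMod N (+ n) (+ 2) j
  else swapMod N (+ i) (+ 1) (swapMod N (ℤ.- (+ suc i)) (+ 1) j)
  where
  N : ℕ
  N = 2 ℕ.* n ℕ.+ 2

ValidLetter : GroupType → ℕ → ℕ → Set
ValidLetter typeA n i = (1 ≤ i) × (i < n)
ValidLetter typeB n i = i < n
ValidLetter typeÃ n i = i < n               -- 0 … n-1  (letter n is written 0)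
ValidLetter typeC̃ n i = i ≤ n

Word : Set
Word = List ℕ

ValidWord : GroupType → ℕ → Word → Set
ValidWord T n u = All (ValidLetter T n) u

eval : GroupType → ℕ → Word → ℤ → ℤ
eval T n []      j = j
eval T n (i ∷ u) j = gen T n i (eval T n u j)

Reduced : GroupType → ℕ → Word → Set
Reduced T n u = (v : Word) → ValidWord T n v →
  ((j : ℤ) → eval T n v j ≡ eval T n u j) → length u ≤ length v

-- the letter for x+1 (in S̃_n the letter n is identified with 0)
nextLetter : GroupType → ℕ → ℕ → ℕ
nextLetter typeÃ n x = if suc x ≡ᵇ n then 0 else suc x
nextLetter _     n x = suc x

HasTriple : GroupType → ℕ → Word → Set
HasTriple T n u = Σ Word λ p → Σ Word λ q → Σ ℕ λ x → Σ ℕ λ y →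
  (1 ≤ x) × (x < n) × ((y ≡ nextLetter T n x) ⊎ (suc y ≡ x)) ×
  (u ≡ p ++ (x ∷ y ∷ x ∷ q))

dis : (ℤ → ℤ) → ℕ → ℕ
dis w zero    = 0
dis w (suc k) = dis w k ℕ.+ ∣ w (+ suc k) ℤ.- (+ suc k) ∣

-- Every element of these groups commutes with the symmetries of ℤ that define the group
-- (negation, translation by the period), so it maps the window [1, n] onto representatives
-- of the same orbits; hence Σ_{j ∈ [1,n]} F (w j) = Σ_{j ∈ [1,n]} F j for every weight F
-- invariant under the symmetries. Applied to the displacement |u j − j| of an element u this,
-- with the triangle inequality, makes dis subadditive along words. A generator moves at most
-- two window positions by 1 (or one by 2), so dis s ≤ 2, while a braid s_x s_{x±1} s_x moves
-- only two positions, each by 2, so dis ≤ 4. A word p · x y x · q therefore has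
-- dis ≤ 2|p| + 4 + 2|q| < 2 ℓ.

module Submission where

import Data.Nat.Properties as ℕₚ

open import Defs
open import Algebra.Properties.CommutativeSemigroup ℕₚ.+-commutativeSemigroup
  using () renaming (interchange to +-interchange; xy∙z≈xz∙y to +-comm-right)
open import Data.Bool using (true; false; T)
open import Data.Bool.Properties using (T-≡)
open import Data.Empty using (⊥-elim)
open import Data.Sum using (_⊎_; inj₁; inj₂)
open import Data.Unit using (⊤; tt)
open import Data.Integer as ℤ using (ℤ; +_; -[1+_]; ∣_∣; _/ℕ_)
open import Data.Integer.DivMod using (a≡a%ℕn+[a/ℕn]*n; n%ℕd<d)
open import Data.Integer.Divisibility.Signed using (_∣_; divides; _∣?_; ∣⇒∣ᵤ; ∣m∣n⇒∣m+n; ∣m⇒∣-m)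
import Data.Integer.Properties as ℤₚ
open import Data.Integer.Tactic.RingSolver using (solve-∀)
open import Data.Nat as ℕ using (ℕ; zero; suc; z≤n; s≤s; _≤_; _<_; _*_)
import Data.Nat.Divisibility as ℕ∣
open import Data.List using ([]; _∷_; _++_; length)
open import Data.List.Properties using (length-++)
open import Data.List.Relation.Unary.All using ([]; _∷_)
open import Data.List.Relation.Unary.All.Properties using (++⁻)
open import Data.Product using (Σ; _×_; _,_; proj₁; proj₂)
open import Relation.Binary.PropositionalEquality
open import Relation.Nullary using (¬_; Dec; yes; no)
open import Relation.Nullary.Decidable using (map′)
open import Function using (_∘_; case_of_; Equivalence)

-- Congruence modulo M

infix 4 _≡[mod_]_ _≡?[mod_]_

record _≡[mod_]_ (a : ℤ) (M : ℕ) (b : ℤ) : Set where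
  constructor mod
  field
    divides-difference : + M ∣ a ℤ.- b

module _ {M : ℕ} where

  mod-reflexive : ∀ {a b} → a ≡ b → a ≡[mod M ] b
  mod-reflexive {a} refl = mod (divides (+ 0) (trans (ℤₚ.+-inverseʳ a) (sym (ℤₚ.*-zeroˡ (+ M)))))

  mod-refl : ∀ {a} → a ≡[mod M ] a
  mod-refl {a} = mod-reflexive {a} refl

  mod-sym : ∀ {a b} → a ≡[mod M ] b → b ≡[mod M ] a
  mod-sym {a} {b} (mod a≡b) = mod (subst (+ M ∣_) (negate-difference a b) (∣m⇒∣-m a≡b))
    where
    negate-difference : ∀ a b → ℤ.- (a ℤ.- b) ≡ b ℤ.- a
    negate-difference = solve-∀

  mod-trans : ∀ {a b c} → a ≡[mod M ] b → b ≡[mod M ] c → a ≡[mod M ] c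
  mod-trans {a} {b} {c} (mod a≡b) (mod b≡c) =
    mod (subst (+ M ∣_) (ℤₚ.+-minus-telescope a b c) (∣m∣n⇒∣m+n a≡b b≡c))

  mod-+ʳ : ∀ {a b} c → a ≡[mod M ] b → a ℤ.+ c ≡[mod M ] b ℤ.+ c
  mod-+ʳ {a} {b} c (mod a≡b) = mod (subst (+ M ∣_) (sym (cancel a b c)) a≡b)
    where
    cancel : ∀ a b c → (a ℤ.+ c) ℤ.- (b ℤ.+ c) ≡ a ℤ.- b
    cancel = solve-∀

  mod-neg : ∀ {a b} → a ≡[mod M ] b → ℤ.- a ≡[mod M ] ℤ.- b
  mod-neg {a} {b} (mod a≡b) = mod (subst (+ M ∣_) (distrib a b) (∣m⇒∣-m a≡b))
    where
    distrib : ∀ a b → ℤ.- (a ℤ.- b) ≡ ℤ.- a ℤ.- ℤ.- b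
    distrib = solve-∀

  mod-+M : ∀ a → a ℤ.+ + M ≡[mod M ] a
  mod-+M a = mod (divides (+ 1) (difference a (+ M)))
    where
    difference : ∀ a m → a ℤ.+ m ℤ.- a ≡ + 1 ℤ.* m
    difference = solve-∀

  mod-unique : ∀ {a b} → ∣ a ℤ.- b ∣ < M → a ≡[mod M ] b → a ≡ b
  mod-unique {a} {b} small (mod a≡b) with ∣ a ℤ.- b ∣ in eq
  ... | zero = ℤₚ.i-j≡0⇒i≡j a b (ℤₚ.∣i∣≡0⇒i≡0 eq)
  ... | suc k = ⊥-elim (ℕ∣.>⇒∤ small (subst (M ℕ∣.∣_) eq (∣⇒∣ᵤ a≡b)))

mod-residue : ∀ m a → a ≡[mod suc m ] + residue (suc m) a
mod-residue m a = mod (divides (a /ℕ suc m) (begin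
  a ℤ.- + r                           ≡⟨ cong (ℤ._- + r) (a≡a%ℕn+[a/ℕn]*n a (suc m)) ⟩
  + r ℤ.+ q ℤ.* + suc m ℤ.- + r       ≡⟨ cancel (+ r) q (+ suc m) ⟩
  q ℤ.* + suc m                       ∎))
  where
  open ≡-Reasoning
  r : ℕ
  r = residue (suc m) a
  q : ℤ
  q = a /ℕ suc m
  cancel : ∀ r q m → r ℤ.+ q ℤ.* m ℤ.- r ≡ q ℤ.* m
  cancel = solve-∀

≡ᵇ-true⇒≡ : ∀ {m n} → (m ℕ.≡ᵇ n) ≡ true → m ≡ n
≡ᵇ-true⇒≡ {m} {n} m≡ᵇn = ℕₚ.≡ᵇ⇒≡ m n (Equivalence.from T-≡ m≡ᵇn)

≡mod-sound : ∀ {M} → 1 ≤ M → ∀ {a b} → ≡mod M a b ≡ true → a ≡[mod M ] b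
≡mod-sound {suc m} _ {a} {b} eq = mod-trans (mod-residue m a)
  (mod-trans (mod-reflexive (cong +_ (≡ᵇ-true⇒≡ eq))) (mod-sym (mod-residue m b)))

≡mod-complete : ∀ {M} → 1 ≤ M → ∀ {a b} → a ≡[mod M ] b → ≡mod M a b ≡ true
≡mod-complete {suc m} _ {a} {b} a≡b = Equivalence.to T-≡ (ℕₚ.≡⇒≡ᵇ _ _ (ℤₚ.+-injective
  (mod-unique residues-close (mod-trans (mod-sym (mod-residue m a)) (mod-trans a≡b (mod-residue m b))))))
  where
  residues-close : ∣ + residue (suc m) a ℤ.- + residue (suc m) b ∣ < suc m
  residues-close rewrite ℤₚ.m-n≡m⊖n (residue (suc m) a) (residue (suc m) b) =
    ℕₚ.≤-<-trans (ℤₚ.∣m⊝n∣≤m⊔n (residue (suc m) a) (residue (suc m) b))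
                 (ℕₚ.⊔-lub (n%ℕd<d a (suc m)) (n%ℕd<d b (suc m)))

≡mod-false : ∀ {M} → 1 ≤ M → ∀ {a b} → ¬ a ≡[mod M ] b → ≡mod M a b ≡ false
≡mod-false {M} 1≤M {a} {b} a≢b with ≡mod M a b in eq
... | true  = ⊥-elim (a≢b (≡mod-sound 1≤M eq))
... | false = refl

_≡?[mod_]_ : ∀ a M b → Dec (a ≡[mod M ] b)
a ≡?[mod M ] b = map′ mod _≡[mod_]_.divides-difference (+ M ∣? a ℤ.- b)

-- Transpositions of ℤ

swapZ-left : ∀ a b → swapZ a b a ≡ b
swapZ-left a b with a ℤ.≟ a
... | yes _  = refl
... | no a≢a = ⊥-elim (a≢a refl)

swapZ-right : ∀ {a b} → a ≢ b → swapZ a b b ≡ a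
swapZ-right {a} {b} a≢b with b ℤ.≟ a | b ℤ.≟ b
... | yes b≡a | _      = ⊥-elim (a≢b (sym b≡a))
... | no _    | yes _  = refl
... | no _    | no b≢b = ⊥-elim (b≢b refl)

swapZ-other : ∀ {a b j} → j ≢ a → j ≢ b → swapZ a b j ≡ j
swapZ-other {a} {b} {j} j≢a j≢b with j ℤ.≟ a | j ℤ.≟ b
... | yes j≡a | _       = ⊥-elim (j≢a j≡a)
... | no _    | yes j≡b = ⊥-elim (j≢b j≡b)
... | no _    | no _    = refl

swapZ-sym : ∀ {a b} → a ≢ b → ∀ j → swapZ a b j ≡ swapZ b a j
swapZ-sym {a} {b} a≢b j = cases (j ℤ.≟ a) (j ℤ.≟ b)
  where
  cases : Dec (j ≡ a) → Dec (j ≡ b) → swapZ a b j ≡ swapZ b a j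
  cases (yes refl) _          = trans (swapZ-left j b) (sym (swapZ-right (≢-sym a≢b)))
  cases (no _)     (yes refl) = trans (swapZ-right a≢b) (sym (swapZ-left j a))
  cases (no j≢a)   (no j≢b)   = trans (swapZ-other j≢a j≢b) (sym (swapZ-other j≢b j≢a))

swapZ-neg : ∀ {a b} → a ≢ b → ∀ j → swapZ (ℤ.- a) (ℤ.- b) (ℤ.- j) ≡ ℤ.- swapZ a b j
swapZ-neg {a} {b} a≢b j = cases (j ℤ.≟ a) (j ℤ.≟ b)
  where
  cases : Dec (j ≡ a) → Dec (j ≡ b) → swapZ (ℤ.- a) (ℤ.- b) (ℤ.- j) ≡ ℤ.- swapZ a b j
  cases (yes refl) _          = trans (swapZ-left (ℤ.- j) (ℤ.- b)) (cong ℤ.-_ (sym (swapZ-left j b)))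
  cases (no _)     (yes refl) = trans (swapZ-right (a≢b ∘ ℤₚ.neg-injective)) (cong ℤ.-_ (sym (swapZ-right a≢b)))
  cases (no j≢a)   (no j≢b)   = trans (swapZ-other (j≢a ∘ ℤₚ.neg-injective) (j≢b ∘ ℤₚ.neg-injective))
                                      (cong ℤ.-_ (sym (swapZ-other j≢a j≢b)))

swapZ-comm : ∀ {a b c d} → a ≢ c → a ≢ d → b ≢ c → b ≢ d → a ≢ b → c ≢ d →
             ∀ j → swapZ a b (swapZ c d j) ≡ swapZ c d (swapZ a b j)
swapZ-comm {a} {b} {c} {d} a≢c a≢d b≢c b≢d a≢b c≢d j = cases (j ℤ.≟ a) (j ℤ.≟ b) (j ℤ.≟ c) (j ℤ.≟ d)
  where
  open ≡-Reasoning
  cases : Dec (j ≡ a) → Dec (j ≡ b) → Dec (j ≡ c) → Dec (j ≡ d) →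
          swapZ a b (swapZ c d j) ≡ swapZ c d (swapZ a b j)
  cases (yes refl) _ _ _ = begin
    swapZ j b (swapZ c d j)  ≡⟨ cong (swapZ j b) (swapZ-other a≢c a≢d) ⟩
    swapZ j b j              ≡⟨ swapZ-left j b ⟩
    b                        ≡⟨ swapZ-other b≢c b≢d ⟨
    swapZ c d b              ≡⟨ cong (swapZ c d) (swapZ-left j b) ⟨
    swapZ c d (swapZ j b j)  ∎
  cases (no _) (yes refl) _ _ = begin
    swapZ a j (swapZ c d j)  ≡⟨ cong (swapZ a j) (swapZ-other b≢c b≢d) ⟩
    swapZ a j j              ≡⟨ swapZ-right a≢b ⟩
    a                        ≡⟨ swapZ-other a≢c a≢d ⟨
    swapZ c d a              ≡⟨ cong (swapZ c d) (swapZ-right a≢b) ⟨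
    swapZ c d (swapZ a j j)  ∎
  cases (no j≢a) (no j≢b) (yes refl) _ = begin
    swapZ a b (swapZ j d j)  ≡⟨ cong (swapZ a b) (swapZ-left j d) ⟩
    swapZ a b d              ≡⟨ swapZ-other (≢-sym a≢d) (≢-sym b≢d) ⟩
    d                        ≡⟨ swapZ-left j d ⟨
    swapZ j d j              ≡⟨ cong (swapZ j d) (swapZ-other j≢a j≢b) ⟨
    swapZ j d (swapZ a b j)  ∎
  cases (no j≢a) (no j≢b) (no _) (yes refl) = begin
    swapZ a b (swapZ c j j)  ≡⟨ cong (swapZ a b) (swapZ-right c≢d) ⟩
    swapZ a b c              ≡⟨ swapZ-other (≢-sym a≢c) (≢-sym b≢c) ⟩
    c                        ≡⟨ swapZ-right c≢d ⟨
    swapZ c j j              ≡⟨ cong (swapZ c j) (swapZ-other j≢a j≢b) ⟨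
    swapZ c j (swapZ a b j)  ∎
  cases (no j≢a) (no j≢b) (no j≢c) (no j≢d) = begin
    swapZ a b (swapZ c d j)  ≡⟨ cong (swapZ a b) (swapZ-other j≢c j≢d) ⟩
    swapZ a b j              ≡⟨ swapZ-other j≢a j≢b ⟩
    j                        ≡⟨ swapZ-other j≢c j≢d ⟨
    swapZ c d j              ≡⟨ cong (swapZ c d) (swapZ-other j≢a j≢b) ⟨
    swapZ c d (swapZ a b j)  ∎

swapZ-conjugate : ∀ {a b c} → a ≢ b → b ≢ c → a ≢ c →
                  ∀ j → swapZ a b (swapZ b c (swapZ a b j)) ≡ swapZ a c j
swapZ-conjugate {a} {b} {c} a≢b b≢c a≢c j = cases (j ℤ.≟ a) (j ℤ.≟ b) (j ℤ.≟ c)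
  where
  open ≡-Reasoning
  cases : Dec (j ≡ a) → Dec (j ≡ b) → Dec (j ≡ c) → swapZ a b (swapZ b c (swapZ a b j)) ≡ swapZ a c j
  cases (yes refl) _ _ = begin
    swapZ j b (swapZ b c (swapZ j b j))  ≡⟨ cong (λ x → swapZ j b (swapZ b c x)) (swapZ-left j b) ⟩
    swapZ j b (swapZ b c b)              ≡⟨ cong (swapZ j b) (swapZ-left b c) ⟩
    swapZ j b c                          ≡⟨ swapZ-other (≢-sym a≢c) (≢-sym b≢c) ⟩
    c                                    ≡⟨ swapZ-left j c ⟨
    swapZ j c j                          ∎
  cases (no _) (yes refl) _ = begin
    swapZ a j (swapZ j c (swapZ a j j))  ≡⟨ cong (λ x → swapZ a j (swapZ j c x)) (swapZ-right a≢b) ⟩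
    swapZ a j (swapZ j c a)              ≡⟨ cong (swapZ a j) (swapZ-other a≢b a≢c) ⟩
    swapZ a j a                          ≡⟨ swapZ-left a j ⟩
    j                                    ≡⟨ swapZ-other (≢-sym a≢b) b≢c ⟨
    swapZ a c j                          ∎
  cases (no j≢a) (no j≢b) (yes refl) = begin
    swapZ a b (swapZ b j (swapZ a b j))  ≡⟨ cong (λ x → swapZ a b (swapZ b j x)) (swapZ-other j≢a j≢b) ⟩
    swapZ a b (swapZ b j j)              ≡⟨ cong (swapZ a b) (swapZ-right b≢c) ⟩
    swapZ a b b                          ≡⟨ swapZ-right a≢b ⟩
    a                                    ≡⟨ swapZ-right a≢c ⟨
    swapZ a j j                          ∎
  cases (no j≢a) (no j≢b) (no j≢c) = begin
    swapZ a b (swapZ b c (swapZ a b j))  ≡⟨ cong (λ x → swapZ a b (swapZ b c x)) (swapZ-other j≢a j≢b) ⟩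
    swapZ a b (swapZ b c j)              ≡⟨ cong (swapZ a b) (swapZ-other j≢b j≢c) ⟩
    swapZ a b j                          ≡⟨ swapZ-other j≢a j≢b ⟩
    j                                    ≡⟨ swapZ-other j≢a j≢c ⟨
    swapZ a c j                          ∎

-- The window [1, n] and periodic transpositions

+-suc : ∀ a → + suc a ≡ + a ℤ.+ + 1
+-suc a = cong +_ (ℕₚ.+-comm 1 a)

InWindow : ℕ → ℕ → Set
InWindow n j = 1 ≤ j × j ≤ n

window-close : ∀ {n i j} → InWindow n i → InWindow n j → ∣ + i ℤ.- + j ∣ < n
window-close {n} {suc i} {suc j} (_ , i≤n) (_ , j≤n)
  rewrite ℤₚ.m-n≡m⊖n (suc i) (suc j) | ℤₚ.[1+m]⊖[1+n]≡m⊖n i j =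
  ℕₚ.≤-<-trans (ℤₚ.∣m⊝n∣≤m⊔n i j) (ℕₚ.⊔-lub i≤n j≤n)

window-unique : ∀ {n i j} → InWindow n i → InWindow n j → + i ≡[mod n ] + j → i ≡ j
window-unique i∈ j∈ i≡j = ℤₚ.+-injective (mod-unique (window-close i∈ j∈) i≡j)

module SwapMod {M : ℕ} (1≤M : 1 ≤ M) where

  swapMod-≡ : ∀ {a} d {j} → j ≡[mod M ] a → swapMod M a d j ≡ j ℤ.+ d
  swapMod-≡ {a} d {j} j≡a rewrite ≡mod-complete 1≤M j≡a = refl

  swapMod-≡+ : ∀ {a} d {j} → ¬ j ≡[mod M ] a → j ≡[mod M ] a ℤ.+ d → swapMod M a d j ≡ j ℤ.- d
  swapMod-≡+ {a} d {j} j≢a j≡a+d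
    rewrite ≡mod-false 1≤M j≢a | ≡mod-complete 1≤M j≡a+d = refl

  swapMod-other : ∀ {a} d {j} → ¬ j ≡[mod M ] a → ¬ j ≡[mod M ] a ℤ.+ d → swapMod M a d j ≡ j
  swapMod-other {a} d {j} j≢a j≢a+d
    rewrite ≡mod-false 1≤M j≢a | ≡mod-false 1≤M j≢a+d = refl

  swapMod-+M : ∀ a d j → swapMod M a d (j ℤ.+ + M) ≡ swapMod M a d j ℤ.+ + M
  swapMod-+M a d j with j ≡?[mod M ] a | j ≡?[mod M ] a ℤ.+ d
  ... | yes j≡a | _ = begin
    swapMod M a d (j ℤ.+ + M)  ≡⟨ swapMod-≡ d (mod-trans (mod-+M j) j≡a) ⟩
    j ℤ.+ + M ℤ.+ d            ≡⟨ swap-last j (+ M) d ⟩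
    j ℤ.+ d ℤ.+ + M            ≡⟨ cong (ℤ._+ + M) (swapMod-≡ d j≡a) ⟨
    swapMod M a d j ℤ.+ + M    ∎
    where
    open ≡-Reasoning
    swap-last : ∀ x y z → x ℤ.+ y ℤ.+ z ≡ x ℤ.+ z ℤ.+ y
    swap-last = solve-∀
  ... | no j≢a | yes j≡a+d = begin
    swapMod M a d (j ℤ.+ + M)  ≡⟨ swapMod-≡+ d (j≢a ∘ mod-trans (mod-sym (mod-+M j))) (mod-trans (mod-+M j) j≡a+d) ⟩
    j ℤ.+ + M ℤ.- d            ≡⟨ swap-last j (+ M) d ⟩
    j ℤ.- d ℤ.+ + M            ≡⟨ cong (ℤ._+ + M) (swapMod-≡+ d j≢a j≡a+d) ⟨
    swapMod M a d j ℤ.+ + M    ∎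
    where
    open ≡-Reasoning
    swap-last : ∀ x y z → x ℤ.+ y ℤ.- z ≡ x ℤ.- z ℤ.+ y
    swap-last = solve-∀
  ... | no j≢a | no j≢a+d = trans
    (swapMod-other d (j≢a ∘ mod-trans (mod-sym (mod-+M j))) (j≢a+d ∘ mod-trans (mod-sym (mod-+M j))))
    (cong (ℤ._+ + M) (sym (swapMod-other d j≢a j≢a+d)))

  ≡mod-respʳ : ∀ j {x y} → x ≡[mod M ] y → ≡mod M j x ≡ ≡mod M j y
  ≡mod-respʳ j {x} x≡y with j ≡?[mod M ] x
  ... | yes j≡x = trans (≡mod-complete 1≤M j≡x) (sym (≡mod-complete 1≤M (mod-trans j≡x x≡y)))
  ... | no j≢x  = trans (≡mod-false 1≤M j≢x)
                    (sym (≡mod-false 1≤M (j≢x ∘ λ j≡y → mod-trans j≡y (mod-sym x≡y))))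

  swapMod-cong : ∀ {a a'} d j → a ≡[mod M ] a' → swapMod M a d j ≡ swapMod M a' d j
  swapMod-cong {a} {a'} d j a≡a'
    rewrite ≡mod-respʳ j a≡a' | ≡mod-respʳ j (mod-+ʳ d a≡a') = refl

  swapMod-neg : ∀ a {d} → ¬ d ≡[mod M ] + 0 → ∀ j →
                swapMod M a d (ℤ.- j) ≡ ℤ.- swapMod M (ℤ.- (a ℤ.+ d)) d j
  swapMod-neg a {d} d≢0 j with j ≡?[mod M ] ℤ.- (a ℤ.+ d) | j ≡?[mod M ] ℤ.- (a ℤ.+ d) ℤ.+ d
  ... | yes j≡a' | _ = begin
    swapMod M a d (ℤ.- j)  ≡⟨ swapMod-≡+ d -j≢a -j≡a+d ⟩
    ℤ.- j ℤ.- d            ≡⟨ neg-+ j d ⟩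
    ℤ.- (j ℤ.+ d)          ≡⟨ cong ℤ.-_ (swapMod-≡ d j≡a') ⟨
    ℤ.- swapMod M _ d j    ∎
    where
    open ≡-Reasoning
    neg-+ : ∀ x y → ℤ.- x ℤ.- y ≡ ℤ.- (x ℤ.+ y)
    neg-+ = solve-∀
    -j≡a+d : ℤ.- j ≡[mod M ] a ℤ.+ d
    -j≡a+d = subst (ℤ.- j ≡[mod M ]_) (ℤₚ.neg-involutive (a ℤ.+ d)) (mod-neg j≡a')
    cancel : ∀ x y → x ℤ.+ y ℤ.+ ℤ.- x ≡ y
    cancel = solve-∀
    -j≢a : ¬ ℤ.- j ≡[mod M ] a
    -j≢a -j≡a = d≢0 (subst₂ _≡[mod M ]_ (cancel a d) (ℤₚ.+-inverseʳ a)
                  (mod-+ʳ (ℤ.- a) (mod-trans (mod-sym -j≡a+d) -j≡a)))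
  ... | no j≢a' | yes j≡a'+d = begin
    swapMod M a d (ℤ.- j)  ≡⟨ swapMod-≡ d -j≡a ⟩
    ℤ.- j ℤ.+ d            ≡⟨ neg-- j d ⟩
    ℤ.- (j ℤ.- d)          ≡⟨ cong ℤ.-_ (swapMod-≡+ d j≢a' j≡a'+d) ⟨
    ℤ.- swapMod M _ d j    ∎
    where
    open ≡-Reasoning
    neg-- : ∀ x y → ℤ.- x ℤ.+ y ≡ ℤ.- (x ℤ.- y)
    neg-- = solve-∀
    neg-shift : ∀ x y → ℤ.- (ℤ.- (x ℤ.+ y) ℤ.+ y) ≡ x
    neg-shift = solve-∀
    -j≡a : ℤ.- j ≡[mod M ] a
    -j≡a = subst (ℤ.- j ≡[mod M ]_) (neg-shift a d) (mod-neg j≡a'+d)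
  ... | no j≢a' | no j≢a'+d =
    trans (swapMod-other d -j≢a -j≢a+d) (cong ℤ.-_ (sym (swapMod-other d j≢a' j≢a'+d)))
    where
    neg-shift : ∀ x y → ℤ.- x ≡ ℤ.- (x ℤ.+ y) ℤ.+ y
    neg-shift = solve-∀
    -j≢a : ¬ ℤ.- j ≡[mod M ] a
    -j≢a -j≡a = j≢a'+d (subst₂ _≡[mod M ]_ (ℤₚ.neg-involutive j) (neg-shift a d) (mod-neg -j≡a))
    -j≢a+d : ¬ ℤ.- j ≡[mod M ] a ℤ.+ d
    -j≢a+d -j≡a+d = j≢a' (subst (_≡[mod M ] _) (ℤₚ.neg-involutive j) (mod-neg -j≡a+d))

  private
    mod-apart : ∀ {x y z} → z ≡[mod M ] x → ¬ x ≡[mod M ] y → ¬ z ≡[mod M ] y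
    mod-apart z≡x x≢y z≡y = x≢y (mod-trans (mod-sym z≡x) z≡y)

    mod-apart′ : ∀ {x y z} → z ≡[mod M ] x → ¬ y ≡[mod M ] x → ¬ z ≡[mod M ] y
    mod-apart′ z≡x y≢x z≡y = y≢x (mod-trans (mod-sym z≡y) z≡x)

    mod-shiftback : ∀ {x y} c → x ≡[mod M ] y ℤ.+ c → x ℤ.- c ≡[mod M ] y
    mod-shiftback {x} {y} c x≡y+c = subst (x ℤ.- c ≡[mod M ]_) (cancel y c) (mod-+ʳ (ℤ.- c) x≡y+c)
      where
      cancel : ∀ y c → y ℤ.+ c ℤ.- c ≡ y
      cancel = solve-∀

  swapMod-comm : ∀ {a d c e} →
    ¬ a ≡[mod M ] c → ¬ a ≡[mod M ] c ℤ.+ e → ¬ a ℤ.+ d ≡[mod M ] c → ¬ a ℤ.+ d ≡[mod M ] c ℤ.+ e →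
    ∀ j → swapMod M a d (swapMod M c e j) ≡ swapMod M c e (swapMod M a d j)
  swapMod-comm {a} {d} {c} {e} a≢c a≢c+e a+d≢c a+d≢c+e j
    with j ≡?[mod M ] a | j ≡?[mod M ] a ℤ.+ d | j ≡?[mod M ] c | j ≡?[mod M ] c ℤ.+ e
  ... | yes j≡a | _ | _ | _ = begin
    swapMod M a d (swapMod M c e j)  ≡⟨ cong (swapMod M a d) (swapMod-other e (mod-apart j≡a a≢c) (mod-apart j≡a a≢c+e)) ⟩
    swapMod M a d j                  ≡⟨ swapMod-≡ d j≡a ⟩
    j ℤ.+ d                          ≡⟨ swapMod-other e (mod-apart j+d≡a+d a+d≢c) (mod-apart j+d≡a+d a+d≢c+e) ⟨
    swapMod M c e (j ℤ.+ d)          ≡⟨ cong (swapMod M c e) (swapMod-≡ d j≡a) ⟨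
    swapMod M c e (swapMod M a d j)  ∎
    where
    open ≡-Reasoning
    j+d≡a+d : j ℤ.+ d ≡[mod M ] a ℤ.+ d
    j+d≡a+d = mod-+ʳ d j≡a
  ... | no j≢a | yes j≡a+d | _ | _ = begin
    swapMod M a d (swapMod M c e j)  ≡⟨ cong (swapMod M a d) (swapMod-other e (mod-apart j≡a+d a+d≢c) (mod-apart j≡a+d a+d≢c+e)) ⟩
    swapMod M a d j                  ≡⟨ swapMod-≡+ d j≢a j≡a+d ⟩
    j ℤ.- d                          ≡⟨ swapMod-other e (mod-apart j-d≡a a≢c) (mod-apart j-d≡a a≢c+e) ⟨
    swapMod M c e (j ℤ.- d)          ≡⟨ cong (swapMod M c e) (swapMod-≡+ d j≢a j≡a+d) ⟨
    swapMod M c e (swapMod M a d j)  ∎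
    where
    open ≡-Reasoning
    j-d≡a : j ℤ.- d ≡[mod M ] a
    j-d≡a = mod-shiftback d j≡a+d
  ... | no j≢a | no j≢a+d | yes j≡c | _ = begin
    swapMod M a d (swapMod M c e j)  ≡⟨ cong (swapMod M a d) (swapMod-≡ e j≡c) ⟩
    swapMod M a d (j ℤ.+ e)          ≡⟨ swapMod-other d (mod-apart′ j+e≡c+e a≢c+e) (mod-apart′ j+e≡c+e a+d≢c+e) ⟩
    j ℤ.+ e                          ≡⟨ swapMod-≡ e j≡c ⟨
    swapMod M c e j                  ≡⟨ cong (swapMod M c e) (swapMod-other d j≢a j≢a+d) ⟨
    swapMod M c e (swapMod M a d j)  ∎
    where
    open ≡-Reasoning
    j+e≡c+e : j ℤ.+ e ≡[mod M ] c ℤ.+ e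
    j+e≡c+e = mod-+ʳ e j≡c
  ... | no j≢a | no j≢a+d | no j≢c | yes j≡c+e = begin
    swapMod M a d (swapMod M c e j)  ≡⟨ cong (swapMod M a d) (swapMod-≡+ e j≢c j≡c+e) ⟩
    swapMod M a d (j ℤ.- e)          ≡⟨ swapMod-other d (mod-apart′ j-e≡c a≢c) (mod-apart′ j-e≡c a+d≢c) ⟩
    j ℤ.- e                          ≡⟨ swapMod-≡+ e j≢c j≡c+e ⟨
    swapMod M c e j                  ≡⟨ cong (swapMod M c e) (swapMod-other d j≢a j≢a+d) ⟨
    swapMod M c e (swapMod M a d j)  ∎
    where
    open ≡-Reasoning
    j-e≡c : j ℤ.- e ≡[mod M ] c
    j-e≡c = mod-shiftback e j≡c+e
  ... | no j≢a | no j≢a+d | no j≢c | no j≢c+e = begin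
    swapMod M a d (swapMod M c e j)  ≡⟨ cong (swapMod M a d) (swapMod-other e j≢c j≢c+e) ⟩
    swapMod M a d j                  ≡⟨ swapMod-other d j≢a j≢a+d ⟩
    j                                ≡⟨ swapMod-other e j≢c j≢c+e ⟨
    swapMod M c e j                  ≡⟨ cong (swapMod M c e) (swapMod-other d j≢a j≢a+d) ⟨
    swapMod M c e (swapMod M a d j)  ∎
    where open ≡-Reasoning

  swapMod-window : ∀ {a j} → 1 ≤ a → suc a ≤ M → InWindow M j →
                   swapMod M (+ a) (+ 1) (+ j) ≡ swapZ (+ a) (+ suc a) (+ j)
  swapMod-window {a} {j} 1≤a a<M j∈ = cases (j ℕ.≟ a) (j ℕ.≟ suc a)
    where
    open ≡-Reasoning
    cases : Dec (j ≡ a) → Dec (j ≡ suc a) → swapMod M (+ a) (+ 1) (+ j) ≡ swapZ (+ a) (+ suc a) (+ j)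
    cases (yes refl) _ = begin
      swapMod M (+ j) (+ 1) (+ j)  ≡⟨ swapMod-≡ (+ 1) mod-refl ⟩
      + j ℤ.+ + 1                  ≡⟨ +-suc j ⟨
      + suc j                      ≡⟨ swapZ-left (+ j) (+ suc j) ⟨
      swapZ (+ j) (+ suc j) (+ j)  ∎
    cases (no j≢a) (yes refl) = begin
      swapMod M (+ a) (+ 1) (+ suc a)  ≡⟨ swapMod-≡+ (+ 1) a+1≢a (mod-reflexive (+-suc a)) ⟩
      + suc a ℤ.- + 1                  ≡⟨ cong (ℤ._- + 1) (+-suc a) ⟩
      + a ℤ.+ + 1 ℤ.- + 1              ≡⟨ cancel (+ a) ⟩
      + a                              ≡⟨ swapZ-right (a≢1+a ∘ ℤₚ.+-injective) ⟨
      swapZ (+ a) (+ suc a) (+ suc a)  ∎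
      where
      cancel : ∀ x → x ℤ.+ + 1 ℤ.- + 1 ≡ x
      cancel = solve-∀
      a≢1+a : a ≢ suc a
      a≢1+a = ℕₚ.<⇒≢ (ℕₚ.n<1+n a)
      a+1≢a : ¬ + suc a ≡[mod M ] + a
      a+1≢a = a≢1+a ∘ sym ∘ window-unique (s≤s z≤n , a<M) (1≤a , ℕₚ.<⇒≤ a<M)
    cases (no j≢a) (no j≢1+a) = begin
      swapMod M (+ a) (+ 1) (+ j)  ≡⟨ swapMod-other (+ 1) (j≢a ∘ window-unique j∈ (1≤a , ℕₚ.<⇒≤ a<M))
                                       (j≢1+a ∘ window-unique j∈ (s≤s z≤n , a<M) ∘ subst (+ j ≡[mod M ]_) (sym (+-suc a))) ⟩
      + j                          ≡⟨ swapZ-other (j≢a ∘ ℤₚ.+-injective) (j≢1+a ∘ ℤₚ.+-injective) ⟨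
      swapZ (+ a) (+ suc a) (+ j)  ∎

-- Sums over the window

windowSum : (ℤ → ℕ) → ℕ → ℕ
windowSum F zero    = 0
windowSum F (suc n) = windowSum F n ℕ.+ F (+ suc n)

module _ {n j : ℕ} where

  inWindow-suc : InWindow n j → InWindow (suc n) j
  inWindow-suc (1≤j , j≤n) = 1≤j , ℕₚ.m≤n⇒m≤1+n j≤n

  inWindow-pred : InWindow (suc n) j → j ≢ suc n → InWindow n j
  inWindow-pred (1≤j , j≤1+n) j≢1+n = 1≤j , ℕₚ.≤-pred (ℕₚ.≤∧≢⇒< j≤1+n j≢1+n)

  inWindow-≢last : InWindow n j → j ≢ suc n
  inWindow-≢last (_ , j≤n) = ℕₚ.<⇒≢ (s≤s j≤n)

inWindow-last : ∀ n → InWindow (suc n) (suc n)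
inWindow-last n = s≤s z≤n , ℕₚ.≤-refl

windowSum-cong : ∀ {F G} n → (∀ j → InWindow n j → F (+ j) ≡ G (+ j)) → windowSum F n ≡ windowSum G n
windowSum-cong zero    F≗G = refl
windowSum-cong (suc n) F≗G =
  cong₂ ℕ._+_ (windowSum-cong n (λ j → F≗G j ∘ inWindow-suc)) (F≗G (suc n) (inWindow-last n))

windowSum-mono : ∀ {F G} n → (∀ j → InWindow n j → F (+ j) ≤ G (+ j)) → windowSum F n ≤ windowSum G n
windowSum-mono zero    F≤G = z≤n
windowSum-mono (suc n) F≤G =
  ℕₚ.+-mono-≤ (windowSum-mono n (λ j → F≤G j ∘ inWindow-suc)) (F≤G (suc n) (inWindow-last n))

windowSum-+ : ∀ F G n → windowSum (λ j → F j ℕ.+ G j) n ≡ windowSum F n ℕ.+ windowSum G n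
windowSum-+ F G zero    = refl
windowSum-+ F G (suc n) = begin
  windowSum (λ j → F j ℕ.+ G j) n ℕ.+ (F (+ suc n) ℕ.+ G (+ suc n))
    ≡⟨ cong (ℕ._+ (F (+ suc n) ℕ.+ G (+ suc n))) (windowSum-+ F G n) ⟩
  windowSum F n ℕ.+ windowSum G n ℕ.+ (F (+ suc n) ℕ.+ G (+ suc n))
    ≡⟨ +-interchange (windowSum F n) (windowSum G n) (F (+ suc n)) (G (+ suc n)) ⟩
  windowSum F n ℕ.+ F (+ suc n) ℕ.+ (windowSum G n ℕ.+ G (+ suc n)) ∎
  where open ≡-Reasoning

windowSum-vanishing : ∀ {F} n → (∀ j → InWindow n j → F (+ j) ≡ 0) → windowSum F n ≡ 0
windowSum-vanishing zero    F≡0 = refl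
windowSum-vanishing (suc n) F≡0 =
  cong₂ ℕ._+_ (windowSum-vanishing n (λ j → F≡0 j ∘ inWindow-suc)) (F≡0 (suc n) (inWindow-last n))

windowSum-≤-one : ∀ {F} n a → (∀ j → InWindow n j → j ≢ a → F (+ j) ≡ 0) → windowSum F n ≤ F (+ a)
windowSum-≤-one         zero    a F≡0 = z≤n
windowSum-≤-one {F} (suc n) a F≡0 with suc n ℕ.≟ a
... | yes refl = ℕₚ.≤-reflexive (cong (ℕ._+ F (+ suc n))
                   (windowSum-vanishing n (λ j j∈ → F≡0 j (inWindow-suc j∈) (inWindow-≢last j∈))))
... | no 1+n≢a = begin
  windowSum F n ℕ.+ F (+ suc n)  ≡⟨ cong (windowSum F n ℕ.+_) (F≡0 (suc n) (inWindow-last n) 1+n≢a) ⟩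
  windowSum F n ℕ.+ 0            ≡⟨ ℕₚ.+-identityʳ _ ⟩
  windowSum F n                  ≤⟨ windowSum-≤-one n a (λ j → F≡0 j ∘ inWindow-suc) ⟩
  F (+ a)                        ∎
  where open ℕₚ.≤-Reasoning

windowSum-≤-two : ∀ {F} n {a b} → a ≢ b → (∀ j → InWindow n j → j ≢ a → j ≢ b → F (+ j) ≡ 0) →
                  windowSum F n ≤ F (+ a) ℕ.+ F (+ b)
windowSum-≤-two         zero    a≢b F≡0 = z≤n
windowSum-≤-two {F} (suc n) {a} {b} a≢b F≡0 with suc n ℕ.≟ a | suc n ℕ.≟ b
... | yes refl | _ = begin
  windowSum F n ℕ.+ F (+ a)  ≤⟨ ℕₚ.+-monoˡ-≤ (F (+ a)) (windowSum-≤-one n b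
                                  (λ j j∈ → F≡0 j (inWindow-suc j∈) (inWindow-≢last j∈))) ⟩
  F (+ b) ℕ.+ F (+ a)        ≡⟨ ℕₚ.+-comm (F (+ b)) (F (+ a)) ⟩
  F (+ a) ℕ.+ F (+ b)        ∎
  where open ℕₚ.≤-Reasoning
... | no _ | yes refl = ℕₚ.+-monoˡ-≤ (F (+ b)) (windowSum-≤-one n a
                          (λ j j∈ j≢a → F≡0 j (inWindow-suc j∈) j≢a (inWindow-≢last j∈)))
... | no 1+n≢a | no 1+n≢b = begin
  windowSum F n ℕ.+ F (+ suc n)  ≡⟨ cong (windowSum F n ℕ.+_) (F≡0 (suc n) (inWindow-last n) 1+n≢a 1+n≢b) ⟩
  windowSum F n ℕ.+ 0            ≡⟨ ℕₚ.+-identityʳ _ ⟩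
  windowSum F n                  ≤⟨ windowSum-≤-two n a≢b (λ j → F≡0 j ∘ inWindow-suc) ⟩
  F (+ a) ℕ.+ F (+ b)            ∎
  where open ℕₚ.≤-Reasoning

windowSum-update : ∀ {F G} n {c} → InWindow n c → (∀ j → InWindow n j → j ≢ c → F (+ j) ≡ G (+ j)) →
                   windowSum F n ℕ.+ G (+ c) ≡ windowSum G n ℕ.+ F (+ c)
windowSum-update         zero    (1≤c , c≤0) F≗G = ⊥-elim (ℕₚ.<⇒≱ 1≤c c≤0)
windowSum-update {F} {G} (suc n) {c} c∈ F≗G with suc n ℕ.≟ c
... | yes refl = begin
  windowSum F n ℕ.+ F (+ c) ℕ.+ G (+ c)  ≡⟨ cong (λ s → s ℕ.+ F (+ c) ℕ.+ G (+ c)) (windowSum-cong n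
                                               (λ j j∈ → F≗G j (inWindow-suc j∈) (inWindow-≢last j∈))) ⟩
  windowSum G n ℕ.+ F (+ c) ℕ.+ G (+ c)  ≡⟨ +-comm-right (windowSum G n) _ _ ⟩
  windowSum G n ℕ.+ G (+ c) ℕ.+ F (+ c)  ∎
  where open ≡-Reasoning
... | no 1+n≢c = begin
  windowSum F n ℕ.+ F (+ suc n) ℕ.+ G (+ c)  ≡⟨ +-comm-right (windowSum F n) _ _ ⟩
  windowSum F n ℕ.+ G (+ c) ℕ.+ F (+ suc n)  ≡⟨ cong₂ ℕ._+_ (windowSum-update n (inWindow-pred c∈ (≢-sym 1+n≢c))
                                                   (λ j → F≗G j ∘ inWindow-suc))
                                                 (F≗G (suc n) (inWindow-last n) 1+n≢c) ⟩
  windowSum G n ℕ.+ F (+ c) ℕ.+ G (+ suc n)  ≡⟨ +-comm-right (windowSum G n) _ _ ⟩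
  windowSum G n ℕ.+ G (+ suc n) ℕ.+ F (+ c)  ∎
  where open ≡-Reasoning

windowSum-swap : ∀ F n {a b} → 1 ≤ a → a < b → b ≤ n →
                 windowSum (F ∘ swapZ (+ a) (+ b)) n ≡ windowSum F n
windowSum-swap F zero    1≤a a<b b≤0 = ⊥-elim (ℕₚ.<⇒≱ (ℕₚ.≤-trans 1≤a (ℕₚ.<⇒≤ a<b)) b≤0)
windowSum-swap F (suc m) {a} {b} 1≤a a<b b≤1+m with b ℕ.≟ suc m
... | yes refl = begin
  windowSum (F ∘ s) m ℕ.+ F (s (+ b))  ≡⟨ cong (λ x → windowSum (F ∘ s) m ℕ.+ F x) (swapZ-right a≢b) ⟩
  windowSum (F ∘ s) m ℕ.+ F (+ a)      ≡⟨ windowSum-update m (1≤a , ℕₚ.≤-pred a<b) F∘s≗F ⟩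
  windowSum F m ℕ.+ F (s (+ a))        ≡⟨ cong (λ x → windowSum F m ℕ.+ F x) (swapZ-left (+ a) (+ b)) ⟩
  windowSum F m ℕ.+ F (+ b)            ∎
  where
  open ≡-Reasoning
  s = swapZ (+ a) (+ b)
  a≢b : + a ≢ + b
  a≢b = ℕₚ.<⇒≢ a<b ∘ ℤₚ.+-injective
  F∘s≗F : ∀ j → InWindow m j → j ≢ a → F (s (+ j)) ≡ F (+ j)
  F∘s≗F j j∈ j≢a = cong F (swapZ-other (j≢a ∘ ℤₚ.+-injective) (inWindow-≢last j∈ ∘ ℤₚ.+-injective))
... | no b≢1+m = cong₂ ℕ._+_ (windowSum-swap F m 1≤a a<b b≤m) (cong F (swapZ-other
    (ℕₚ.<⇒≢ (ℕₚ.<-trans a<b (s≤s b≤m)) ∘ sym ∘ ℤₚ.+-injective)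
    (ℕₚ.<⇒≢ (s≤s b≤m) ∘ sym ∘ ℤₚ.+-injective)))
  where
  b≤m : b ≤ m
  b≤m = ℕₚ.≤-pred (ℕₚ.≤∧≢⇒< b≤1+m b≢1+m)

-- Displacement

EqualOnWindow : ℕ → (ℤ → ℤ) → (ℤ → ℤ) → Set
EqualOnWindow n f g = ∀ j → InWindow n j → f (+ j) ≡ g (+ j)

∣[k+a]-a∣≡k : ∀ k a → ∣ + (k ℕ.+ a) ℤ.- + a ∣ ≡ k
∣[k+a]-a∣≡k k a = cong ∣_∣ (trans (cong (ℤ._- + a) (ℤₚ.pos-+ k a)) (cancel (+ k) (+ a)))
  where
  cancel : ∀ x y → x ℤ.+ y ℤ.- y ≡ x
  cancel = solve-∀

∣a-[k+a]∣≡k : ∀ k a → ∣ + a ℤ.- + (k ℕ.+ a) ∣ ≡ k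
∣a-[k+a]∣≡k k a = trans (ℤₚ.∣i-j∣≡∣j-i∣ (+ a) (+ (k ℕ.+ a))) (∣[k+a]-a∣≡k k a)

dis-windowSum : ∀ w n → dis w n ≡ windowSum (λ j → ∣ w j ℤ.- j ∣) n
dis-windowSum w zero    = refl
dis-windowSum w (suc n) = cong (ℕ._+ ∣ w (+ suc n) ℤ.- + suc n ∣) (dis-windowSum w n)

dis-cong : ∀ {f g} n → EqualOnWindow n f g → dis f n ≡ dis g n
dis-cong {f} {g} n f≗g = begin
  dis f n                             ≡⟨ dis-windowSum f n ⟩
  windowSum (λ j → ∣ f j ℤ.- j ∣) n   ≡⟨ windowSum-cong n (λ j j∈ → cong (λ x → ∣ x ℤ.- + j ∣) (f≗g j j∈)) ⟩
  windowSum (λ j → ∣ g j ℤ.- j ∣) n   ≡⟨ dis-windowSum g n ⟨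
  dis g n                             ∎
  where open ≡-Reasoning

dis-id : ∀ n → dis (λ j → j) n ≡ 0
dis-id zero    = refl
dis-id (suc n) = cong₂ ℕ._+_ (dis-id n) (cong ∣_∣ (ℤₚ.+-inverseʳ (+ suc n)))

private
  displacement-fixed : ∀ {x} j → x ≡ + j → ∣ x ℤ.- + j ∣ ≡ 0
  displacement-fixed j refl = cong ∣_∣ (ℤₚ.+-inverseʳ (+ j))

dis-≤-one : ∀ {f} n a {v} → f (+ a) ≡ v → (∀ j → InWindow n j → j ≢ a → f (+ j) ≡ + j) →
            dis f n ≤ ∣ v ℤ.- + a ∣
dis-≤-one {f} n a {v} fa≡v fixed = begin
  dis f n                            ≡⟨ dis-windowSum f n ⟩
  windowSum (λ j → ∣ f j ℤ.- j ∣) n  ≤⟨ windowSum-≤-one n a (λ j j∈ → displacement-fixed j ∘ fixed j j∈) ⟩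
  ∣ f (+ a) ℤ.- + a ∣                ≡⟨ cong (λ x → ∣ x ℤ.- + a ∣) fa≡v ⟩
  ∣ v ℤ.- + a ∣                      ∎
  where open ℕₚ.≤-Reasoning

dis-≤-two : ∀ {f} n {a b va vb} → a ≢ b → f (+ a) ≡ va → f (+ b) ≡ vb →
            (∀ j → InWindow n j → j ≢ a → j ≢ b → f (+ j) ≡ + j) →
            dis f n ≤ ∣ va ℤ.- + a ∣ ℕ.+ ∣ vb ℤ.- + b ∣
dis-≤-two {f} n {a} {b} {va} {vb} a≢b fa≡va fb≡vb fixed = begin
  dis f n
    ≡⟨ dis-windowSum f n ⟩
  windowSum (λ j → ∣ f j ℤ.- j ∣) n
    ≤⟨ windowSum-≤-two n a≢b (λ j j∈ j≢a → displacement-fixed j ∘ fixed j j∈ j≢a) ⟩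
  ∣ f (+ a) ℤ.- + a ∣ ℕ.+ ∣ f (+ b) ℤ.- + b ∣
    ≡⟨ cong₂ (λ x y → ∣ x ℤ.- + a ∣ ℕ.+ ∣ y ℤ.- + b ∣) fa≡va fb≡vb ⟩
  ∣ va ℤ.- + a ∣ ℕ.+ ∣ vb ℤ.- + b ∣
    ∎
  where open ℕₚ.≤-Reasoning

dis-swap : ∀ {f} n {a} k → suc k ℕ.+ a ≤ n → 1 ≤ a →
           EqualOnWindow n f (swapZ (+ a) (+ (suc k ℕ.+ a))) → dis f n ≤ suc k ℕ.+ suc k
dis-swap {f} n {a} k b≤n 1≤a f≗s = begin
  dis f n                              ≤⟨ dis-≤-two n a≢b fa fb fixed ⟩
  ∣ + b ℤ.- + a ∣ ℕ.+ ∣ + a ℤ.- + b ∣  ≡⟨ cong₂ ℕ._+_ (∣[k+a]-a∣≡k (suc k) a) (∣a-[k+a]∣≡k (suc k) a) ⟩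
  suc k ℕ.+ suc k                      ∎
  where
  open ℕₚ.≤-Reasoning
  b : ℕ
  b = suc k ℕ.+ a
  a<b : a < b
  a<b = s≤s (ℕₚ.m≤n+m a k)
  a≢b : a ≢ b
  a≢b = ℕₚ.<⇒≢ a<b
  a∈ : InWindow n a
  a∈ = 1≤a , ℕₚ.≤-trans (ℕₚ.<⇒≤ a<b) b≤n
  fa : f (+ a) ≡ + b
  fa = trans (f≗s a a∈) (swapZ-left (+ a) (+ b))
  fb : f (+ b) ≡ + a
  fb = trans (f≗s b (s≤s z≤n , b≤n)) (swapZ-right (a≢b ∘ ℤₚ.+-injective))
  fixed : ∀ j → InWindow n j → j ≢ a → j ≢ b → f (+ j) ≡ + j
  fixed j j∈ j≢a j≢b = trans (f≗s j j∈) (swapZ-other (j≢a ∘ ℤₚ.+-injective) (j≢b ∘ ℤₚ.+-injective))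

windowSum-∘-swap : ∀ F {f} n {a b} → 1 ≤ a → a < b → b ≤ n → EqualOnWindow n f (swapZ (+ a) (+ b)) →
                   windowSum (F ∘ f) n ≡ windowSum F n
windowSum-∘-swap F n 1≤a a<b b≤n f≗s =
  trans (windowSum-cong n (λ j j∈ → cong F (f≗s j j∈))) (windowSum-swap F n 1≤a a<b b≤n)

swapZ-window : ∀ {n a b j} → InWindow n a → InWindow n b → InWindow n j →
               Σ ℕ λ k → InWindow n k × swapZ (+ a) (+ b) (+ j) ≡ + k
swapZ-window {n} {a} {b} {j} a∈ b∈ j∈ = cases (j ℕ.≟ a) (j ℕ.≟ b)
  where
  cases : Dec (j ≡ a) → Dec (j ≡ b) → Σ ℕ λ k → InWindow n k × swapZ (+ a) (+ b) (+ j) ≡ + k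
  cases (yes refl) _          = b , b∈ , swapZ-left (+ j) (+ b)
  cases (no j≢a)   (yes refl) = a , a∈ , swapZ-right (j≢a ∘ sym ∘ ℤₚ.+-injective)
  cases (no j≢a)   (no j≢b)   = j , j∈ , swapZ-other (j≢a ∘ ℤₚ.+-injective) (j≢b ∘ ℤₚ.+-injective)

EqualOnWindow-∘-swap : ∀ {n f g h a b} → InWindow n a → InWindow n b →
  EqualOnWindow n f (swapZ (+ a) (+ b)) → EqualOnWindow n g h →
  EqualOnWindow n (g ∘ f) (h ∘ swapZ (+ a) (+ b))
EqualOnWindow-∘-swap {f = f} {g} {h} {a} {b} a∈ b∈ f≗s g≗h j j∈ with swapZ-window a∈ b∈ j∈
... | k , k∈ , sj≡k = begin
  g (f (+ j))                  ≡⟨ cong g (trans (f≗s j j∈) sj≡k) ⟩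
  g (+ k)                      ≡⟨ g≗h k k∈ ⟩
  h (+ k)                      ≡⟨ cong h sj≡k ⟨
  h (swapZ (+ a) (+ b) (+ j))  ∎
  where open ≡-Reasoning

EqualOnWindow-braid : ∀ {n f g a b c} → InWindow n a → InWindow n b → InWindow n c →
  a ≢ b → b ≢ c → a ≢ c →
  EqualOnWindow n f (swapZ (+ a) (+ b)) → EqualOnWindow n g (swapZ (+ b) (+ c)) →
  EqualOnWindow n (λ j → f (g (f j))) (swapZ (+ a) (+ c))
EqualOnWindow-braid {f = f} {g} {a} {b} {c} a∈ b∈ c∈ a≢b b≢c a≢c f≗s g≗t j j∈ =
  trans (EqualOnWindow-∘-swap {f = f} {g = f ∘ g} {h = s-ab ∘ swapZ (+ b) (+ c)} a∈ b∈ f≗s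
          (EqualOnWindow-∘-swap {f = g} {g = f} {h = s-ab} b∈ c∈ g≗t f≗s) j j∈)
        (swapZ-conjugate (a≢b ∘ ℤₚ.+-injective) (b≢c ∘ ℤₚ.+-injective) (a≢c ∘ ℤₚ.+-injective) (+ j))
  where
  s-ab : ℤ → ℤ
  s-ab = swapZ (+ a) (+ b)

module _ (f g : ℤ → ℤ) {n x : ℕ} (1≤x : 1 ≤ x) (x+2≤n : 2 ℕ.+ x ≤ n) where

  private
    x∈ : InWindow n x
    x∈ = 1≤x , ℕₚ.≤-trans (ℕₚ.m≤n+m x 2) x+2≤n
    x+1∈ : InWindow n (suc x)
    x+1∈ = s≤s z≤n , ℕₚ.≤-trans (ℕₚ.n≤1+n (suc x)) x+2≤n
    x+2∈ : InWindow n (2 ℕ.+ x)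
    x+2∈ = s≤s z≤n , x+2≤n
    x≢x+1 : x ≢ suc x
    x≢x+1 = ℕₚ.<⇒≢ (ℕₚ.n<1+n x)
    x+1≢x+2 : suc x ≢ 2 ℕ.+ x
    x+1≢x+2 = ℕₚ.<⇒≢ (ℕₚ.n<1+n (suc x))
    x≢x+2 : x ≢ 2 ℕ.+ x
    x≢x+2 = ℕₚ.<⇒≢ (ℕₚ.m≤n+m (suc x) 1)

  dis-braid-up : EqualOnWindow n f (swapZ (+ x) (+ suc x)) → EqualOnWindow n g (swapZ (+ suc x) (+ (2 ℕ.+ x))) →
                 dis (λ j → f (g (f j))) n ≤ 4
  dis-braid-up f≗s g≗t = dis-swap n 1 x+2≤n 1≤x
    (EqualOnWindow-braid {f = f} {g} x∈ x+1∈ x+2∈ x≢x+1 x+1≢x+2 x≢x+2 f≗s g≗t)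

  dis-braid-down : EqualOnWindow n f (swapZ (+ suc x) (+ (2 ℕ.+ x))) → EqualOnWindow n g (swapZ (+ x) (+ suc x)) →
                   dis (λ j → f (g (f j))) n ≤ 4
  dis-braid-down f≗s g≗t = dis-swap n 1 x+2≤n 1≤x λ j j∈ →
    trans (EqualOnWindow-braid {f = f} {g} x+2∈ x+1∈ x∈ (≢-sym x+1≢x+2) (≢-sym x≢x+1) (≢-sym x≢x+2)
                               (λ i i∈ → trans (f≗s i i∈) (swapZ-sym (x+1≢x+2 ∘ ℤₚ.+-injective) (+ i)))
                               (λ i i∈ → trans (g≗t i i∈) (swapZ-sym (x≢x+1 ∘ ℤₚ.+-injective) (+ i))) j j∈)
          (swapZ-sym (≢-sym x≢x+2 ∘ ℤₚ.+-injective) (+ j))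

-- Symmetries and subadditivity of the displacement

-- The symmetries of ℤ commuting with the group elements: none for S_n (whose elements fix
-- everything outside [1, n]), negation for S^B_n, translation by n for S̃_n, and for S̃^C_n
-- negation and translation by 2n + 2, which generate the reflection i ↦ 2(n + 1) − i.
Equivariant : GroupType → ℕ → (ℤ → ℤ) → Set
Equivariant typeA n w = ⊤
Equivariant typeB n w = ∀ j → w (ℤ.- j) ≡ ℤ.- w j
Equivariant typeÃ n w = ∀ j → w (j ℤ.+ + n) ≡ w j ℤ.+ + n
Equivariant typeC̃ n w =
  (∀ j → w (ℤ.- j) ≡ ℤ.- w j) × (∀ j → w (j ℤ.+ + (2 ℕ.* n ℕ.+ 2)) ≡ w j ℤ.+ + (2 ℕ.* n ℕ.+ 2))

Invariant : GroupType → ℕ → (ℤ → ℕ) → Set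
Invariant typeA n F = ⊤
Invariant typeB n F = ∀ j → F (ℤ.- j) ≡ F j
Invariant typeÃ n F = ∀ j → F (j ℤ.+ + n) ≡ F j
Invariant typeC̃ n F = (∀ j → F (ℤ.- j) ≡ F j) × (∀ j → F (j ℤ.+ + (2 ℕ.* n ℕ.+ 2)) ≡ F j)

Equivariant-id : ∀ T n → Equivariant T n (λ j → j)
Equivariant-id typeA n = tt
Equivariant-id typeB n = λ _ → refl
Equivariant-id typeÃ n = λ _ → refl
Equivariant-id typeC̃ n = (λ _ → refl) , (λ _ → refl)

Equivariant-∘ : ∀ T n {w v} → Equivariant T n w → Equivariant T n v → Equivariant T n (w ∘ v)
Equivariant-∘ typeA n _ _ = tt
Equivariant-∘ typeB n {w} {v} w-odd v-odd j = trans (cong w (v-odd j)) (w-odd (v j))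
Equivariant-∘ typeÃ n {w} {v} w-per v-per j = trans (cong w (v-per j)) (w-per (v j))
Equivariant-∘ typeC̃ n {w} {v} (w-odd , w-per) (v-odd , v-per) =
  (λ j → trans (cong w (v-odd j)) (w-odd (v j))) , (λ j → trans (cong w (v-per j)) (w-per (v j)))

Invariant-∘ : ∀ T n {F v} → Equivariant T n v → Invariant T n F → Invariant T n (F ∘ v)
Invariant-∘ typeA n _ _ = tt
Invariant-∘ typeB n {F} {v} v-odd F-even j = trans (cong F (v-odd j)) (F-even (v j))
Invariant-∘ typeÃ n {F} {v} v-per F-per j = trans (cong F (v-per j)) (F-per (v j))
Invariant-∘ typeC̃ n {F} {v} (v-odd , v-per) (F-even , F-per) =
  (λ j → trans (cong F (v-odd j)) (F-even (v j))) , (λ j → trans (cong F (v-per j)) (F-per (v j)))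

∣-a--b∣≡∣a-b∣ : ∀ a b → ∣ ℤ.- a ℤ.- ℤ.- b ∣ ≡ ∣ a ℤ.- b ∣
∣-a--b∣≡∣a-b∣ a b = trans (cong ∣_∣ (neg-distrib a b)) (ℤₚ.∣-i∣≡∣i∣ (a ℤ.- b))
  where
  neg-distrib : ∀ a b → ℤ.- a ℤ.- ℤ.- b ≡ ℤ.- (a ℤ.- b)
  neg-distrib = solve-∀

∣[a+c]-[b+c]∣≡∣a-b∣ : ∀ a b c → ∣ (a ℤ.+ c) ℤ.- (b ℤ.+ c) ∣ ≡ ∣ a ℤ.- b ∣
∣[a+c]-[b+c]∣≡∣a-b∣ a b c = cong ∣_∣ (cancel a b c)
  where
  cancel : ∀ a b c → (a ℤ.+ c) ℤ.- (b ℤ.+ c) ≡ a ℤ.- b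
  cancel = solve-∀

Invariant-displacement : ∀ T n {w} → Equivariant T n w → Invariant T n (λ j → ∣ w j ℤ.- j ∣)
Invariant-displacement typeA n _ = tt
Invariant-displacement typeB n {w} w-odd j =
  trans (cong (λ x → ∣ x ℤ.- ℤ.- j ∣) (w-odd j)) (∣-a--b∣≡∣a-b∣ (w j) j)
Invariant-displacement typeÃ n {w} w-per j =
  trans (cong (λ x → ∣ x ℤ.- (j ℤ.+ + n) ∣) (w-per j)) (∣[a+c]-[b+c]∣≡∣a-b∣ (w j) j (+ n))
Invariant-displacement typeC̃ n {w} (w-odd , w-per) =
  (λ j → trans (cong (λ x → ∣ x ℤ.- ℤ.- j ∣) (w-odd j)) (∣-a--b∣≡∣a-b∣ (w j) j)) ,
  (λ j → trans (cong (λ x → ∣ x ℤ.- (j ℤ.+ + M) ∣) (w-per j)) (∣[a+c]-[b+c]∣≡∣a-b∣ (w j) j (+ M)))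
  where
  M = 2 ℕ.* n ℕ.+ 2

PreservesWindowSums : GroupType → ℕ → (ℤ → ℤ) → Set
PreservesWindowSums T n v = ∀ F → Invariant T n F → windowSum (F ∘ v) n ≡ windowSum F n

PreservesWindowSums-id : ∀ T n → PreservesWindowSums T n (λ j → j)
PreservesWindowSums-id T n F _ = refl

PreservesWindowSums-∘ : ∀ T n {w v} → Equivariant T n w →
  PreservesWindowSums T n w → PreservesWindowSums T n v → PreservesWindowSums T n (w ∘ v)
PreservesWindowSums-∘ T n {w} w-equi w-pres v-pres F F-inv =
  trans (v-pres (F ∘ w) (Invariant-∘ T n w-equi F-inv)) (w-pres F F-inv)

∣a-c∣≤∣a-b∣+∣b-c∣ : ∀ a b c → ∣ a ℤ.- c ∣ ≤ ∣ a ℤ.- b ∣ ℕ.+ ∣ b ℤ.- c ∣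
∣a-c∣≤∣a-b∣+∣b-c∣ a b c =
  subst (λ x → ∣ x ∣ ≤ ∣ a ℤ.- b ∣ ℕ.+ ∣ b ℤ.- c ∣) (ℤₚ.+-minus-telescope a b c)
        (ℤₚ.∣i+j∣≤∣i∣+∣j∣ (a ℤ.- b) (b ℤ.- c))

-- v permutes the window up to symmetries, and the displacement of w is an invariant weight.
dis-∘-≤ : ∀ T n {w v} → Equivariant T n w → PreservesWindowSums T n v →
          dis (w ∘ v) n ≤ dis w n ℕ.+ dis v n
dis-∘-≤ T n {w} {v} w-equi v-pres = begin
  dis (w ∘ v) n
    ≡⟨ dis-windowSum (w ∘ v) n ⟩
  windowSum (λ j → ∣ w (v j) ℤ.- j ∣) n
    ≤⟨ windowSum-mono n (λ j _ → ∣a-c∣≤∣a-b∣+∣b-c∣ (w (v (+ j))) (v (+ j)) (+ j)) ⟩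
  windowSum (λ j → ∣ w (v j) ℤ.- v j ∣ ℕ.+ ∣ v j ℤ.- j ∣) n
    ≡⟨ windowSum-+ (λ j → ∣ w (v j) ℤ.- v j ∣) (λ j → ∣ v j ℤ.- j ∣) n ⟩
  windowSum (λ j → ∣ w (v j) ℤ.- v j ∣) n ℕ.+ windowSum (λ j → ∣ v j ℤ.- j ∣) n
    ≡⟨ cong₂ ℕ._+_ (v-pres _ (Invariant-displacement T n w-equi)) (sym (dis-windowSum v n)) ⟩
  windowSum (λ j → ∣ w j ℤ.- j ∣) n ℕ.+ dis v n
    ≡⟨ cong (ℕ._+ dis v n) (dis-windowSum w n) ⟨
  dis w n ℕ.+ dis v n
    ∎
  where open ℕₚ.≤-Reasoning

-- Words

Braid : GroupType → ℕ → ℕ → ℕ → ℤ → ℤ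
Braid T n x y = gen T n x ∘ gen T n y ∘ gen T n x

record GeneratorBounds (T : GroupType) (n : ℕ) : Set where
  field
    gen-equivariant         : ∀ {i} → ValidLetter T n i → Equivariant T n (gen T n i)
    gen-preservesWindowSums : ∀ {i} → ValidLetter T n i → PreservesWindowSums T n (gen T n i)
    dis-gen≤2               : ∀ {i} → ValidLetter T n i → dis (gen T n i) n ≤ 2
    dis-braid≤4             : ∀ {x y} → 1 ≤ x → x < n → (y ≡ nextLetter T n x ⊎ suc y ≡ x) →
                              ValidLetter T n x → ValidLetter T n y → dis (Braid T n x y) n ≤ 4

eval-++ : ∀ T n p q j → eval T n (p ++ q) j ≡ eval T n p (eval T n q j)
eval-++ T n []      q j = refl
eval-++ T n (i ∷ p) q j = cong (gen T n i) (eval-++ T n p q j)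

module WordBounds {T : GroupType} {n : ℕ} (bounds : GeneratorBounds T n) where
  open GeneratorBounds bounds

  eval-equivariant : ∀ {u} → ValidWord T n u → Equivariant T n (eval T n u)
  eval-equivariant []        = Equivariant-id T n
  eval-equivariant (vi ∷ vu) = Equivariant-∘ T n (gen-equivariant vi) (eval-equivariant vu)

  eval-preservesWindowSums : ∀ {u} → ValidWord T n u → PreservesWindowSums T n (eval T n u)
  eval-preservesWindowSums []        = PreservesWindowSums-id T n
  eval-preservesWindowSums (vi ∷ vu) =
    PreservesWindowSums-∘ T n (gen-equivariant vi) (gen-preservesWindowSums vi) (eval-preservesWindowSums vu)

  dis-eval≤2*length : ∀ {u} → ValidWord T n u → dis (eval T n u) n ≤ 2 * length u
  dis-eval≤2*length [] = ℕₚ.≤-reflexive (dis-id n)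
  dis-eval≤2*length {i ∷ u} (vi ∷ vu) = begin
    dis (eval T n (i ∷ u)) n                  ≤⟨ dis-∘-≤ T n (gen-equivariant vi) (eval-preservesWindowSums vu) ⟩
    dis (gen T n i) n ℕ.+ dis (eval T n u) n  ≤⟨ ℕₚ.+-mono-≤ (dis-gen≤2 vi) (dis-eval≤2*length vu) ⟩
    2 ℕ.+ 2 * length u                        ≡⟨ ℕₚ.*-distribˡ-+ 2 1 (length u) ⟨
    2 * length (i ∷ u)                        ∎
    where open ℕₚ.≤-Reasoning

  dis-eval-++≤ : ∀ {p r} → ValidWord T n p → ValidWord T n r →
                 dis (eval T n (p ++ r)) n ≤ dis (eval T n p) n ℕ.+ dis (eval T n r) n
  dis-eval-++≤ {p} {r} vp vr = begin
    dis (eval T n (p ++ r)) n                       ≡⟨ dis-cong n (λ j _ → eval-++ T n p r (+ j)) ⟩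
    dis (eval T n p ∘ eval T n r) n                 ≤⟨ dis-∘-≤ T n (eval-equivariant vp) (eval-preservesWindowSums vr) ⟩
    dis (eval T n p) n ℕ.+ dis (eval T n r) n       ∎
    where open ℕₚ.≤-Reasoning

  dis-eval-braid< : ∀ p q {x y} → ValidWord T n (p ++ x ∷ y ∷ x ∷ q) → 1 ≤ x → x < n →
                    (y ≡ nextLetter T n x ⊎ suc y ≡ x) →
                    dis (eval T n (p ++ x ∷ y ∷ x ∷ q)) n < 2 * length (p ++ x ∷ y ∷ x ∷ q)
  dis-eval-braid< p q {x} {y} vw 1≤x x<n y-adj with ++⁻ p vw
  ... | vp , vx ∷ vy ∷ _ ∷ vq = begin-strict
    dis (eval T n (p ++ x ∷ y ∷ x ∷ q)) n
      ≤⟨ dis-eval-++≤ vp (vx ∷ vy ∷ vx ∷ vq) ⟩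
    dis (eval T n p) n ℕ.+ dis (eval T n (x ∷ y ∷ x ∷ q)) n
      ≤⟨ ℕₚ.+-mono-≤ (dis-eval≤2*length vp) (dis-eval-++≤ (vx ∷ vy ∷ vx ∷ []) vq) ⟩
    2 * length p ℕ.+ (dis (Braid T n x y) n ℕ.+ dis (eval T n q) n)
      ≤⟨ ℕₚ.+-monoʳ-≤ (2 * length p) (ℕₚ.+-mono-≤ (dis-braid≤4 1≤x x<n y-adj vx vy) (dis-eval≤2*length vq)) ⟩
    2 * length p ℕ.+ (4 ℕ.+ 2 * length q)
      <⟨ ℕₚ.+-monoʳ-< (2 * length p) (ℕₚ.+-monoˡ-< (2 * length q) (ℕₚ.m<m+n 4 {2} (s≤s z≤n))) ⟩
    2 * length p ℕ.+ (6 ℕ.+ 2 * length q)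
      ≡⟨ cong (2 * length p ℕ.+_) (ℕₚ.*-distribˡ-+ 2 3 (length q)) ⟨
    2 * length p ℕ.+ 2 * (3 ℕ.+ length q)
      ≡⟨ ℕₚ.*-distribˡ-+ 2 (length p) (3 ℕ.+ length q) ⟨
    2 * (length p ℕ.+ length (x ∷ y ∷ x ∷ q))
      ≡⟨ cong (2 *_) (length-++ p) ⟨
    2 * length (p ++ x ∷ y ∷ x ∷ q)
      ∎
    where open ℕₚ.≤-Reasoning

-- The four groups

module TypeA (n : ℕ) where

  s : ℕ → ℤ → ℤ
  s = gen typeA n

  bounds : GeneratorBounds typeA n
  bounds = record
    { gen-equivariant         = λ _ → tt
    ; gen-preservesWindowSums = λ (1≤i , i<n) F _ → windowSum-∘-swap F n 1≤i (ℕₚ.n<1+n _) i<n (λ _ _ → refl)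
    ; dis-gen≤2               = λ (1≤i , i<n) → dis-swap n 0 i<n 1≤i (λ _ _ → refl)
    ; dis-braid≤4             = dis-braid≤4
    }
    where
    dis-braid≤4 : ∀ {x y} → 1 ≤ x → x < n → (y ≡ suc x ⊎ suc y ≡ x) →
                  ValidLetter typeA n x → ValidLetter typeA n y → dis (Braid typeA n x y) n ≤ 4
    dis-braid≤4 {x} 1≤x _ (inj₁ refl) _ (_ , x+1<n) =
      dis-braid-up (s x) (s (suc x)) 1≤x x+1<n (λ _ _ → refl) (λ _ _ → refl)
    dis-braid≤4 {_} {y} _ x<n (inj₂ refl) _ (1≤y , _) =
      dis-braid-down (s (suc y)) (s y) 1≤y x<n (λ _ _ → refl) (λ _ _ → refl)

module TypeB (n : ℕ) where

  s : ℕ → ℤ → ℤ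
  s = gen typeB n

  s-window : ∀ k → EqualOnWindow n (s (suc k)) (swapZ (+ suc k) (+ suc (suc k)))
  s-window k j _ = cong (swapZ (+ suc k) (+ suc (suc k)))
    (swapZ-other {ℤ.- (+ suc k)} { ℤ.- (+ suc (suc k)) } {+ j} (λ ()) (λ ()))

  s₀-fixes : ∀ {j} → j ≢ 1 → s 0 (+ j) ≡ + j
  s₀-fixes j≢1 = swapZ-other { -[1+ 0 ] } {+ 1} (λ ()) (j≢1 ∘ ℤₚ.+-injective)

  s-odd : ∀ i j → s i (ℤ.- j) ≡ ℤ.- s i j
  s-odd zero j = trans (swapZ-neg {+ 1} { -[1+ 0 ] } (λ ()) j) (cong ℤ.-_ (swapZ-sym (λ ()) j))
  s-odd (suc k) j = begin
    S (S′ (ℤ.- j))   ≡⟨ cong S (swapZ-neg P≢Q j) ⟩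
    S (ℤ.- S j)      ≡⟨ swapZ-neg′ P≢Q (S j) ⟩
    ℤ.- S′ (S j)     ≡⟨ cong ℤ.-_ (swapZ-comm (λ ()) (λ ()) (λ ()) (λ ()) P≢Q (P≢Q ∘ ℤₚ.neg-injective) j) ⟨
    ℤ.- S (S′ j)     ∎
    where
    open ≡-Reasoning
    P Q : ℤ
    P = + suc k
    Q = + suc (suc k)
    S S′ : ℤ → ℤ
    S = swapZ P Q
    S′ = swapZ (ℤ.- P) (ℤ.- Q)
    P≢Q : P ≢ Q
    P≢Q = ℕₚ.<⇒≢ (ℕₚ.n<1+n (suc k)) ∘ ℤₚ.+-injective
    swapZ-neg′ : ∀ {a b} → a ≢ b → ∀ x → swapZ a b (ℤ.- x) ≡ ℤ.- swapZ (ℤ.- a) (ℤ.- b) x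
    swapZ-neg′ {a} {b} a≢b x = subst₂ (λ u v → swapZ u v (ℤ.- x) ≡ ℤ.- swapZ (ℤ.- a) (ℤ.- b) x)
      (ℤₚ.neg-involutive a) (ℤₚ.neg-involutive b) (swapZ-neg (a≢b ∘ ℤₚ.neg-injective) x)

  s-preservesWindowSums : ∀ {i} → ValidLetter typeB n i → PreservesWindowSums typeB n (s i)
  s-preservesWindowSums {suc k} k<n F _ = windowSum-∘-swap F n (s≤s z≤n) (ℕₚ.n<1+n (suc k)) k<n (s-window k)
  s-preservesWindowSums {zero}  _   F F-even = windowSum-cong n λ j _ → F∘s₀≗F j
    where
    F∘s₀≗F : ∀ j → F (s 0 (+ j)) ≡ F (+ j)
    F∘s₀≗F j = case j ℕ.≟ 1 of λ where
      (yes refl) → F-even (+ 1)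
      (no j≢1)   → cong F (s₀-fixes j≢1)

  dis-s≤2 : ∀ {i} → ValidLetter typeB n i → dis (s i) n ≤ 2
  dis-s≤2 {suc k} k<n = dis-swap n 0 k<n (s≤s z≤n) (s-window k)
  dis-s≤2 {zero}  _   = dis-≤-one n 1 refl (λ _ _ → s₀-fixes)

  -- s₁ s₀ s₁ exchanges 2 and -2
  dis-s₁s₀s₁≤4 : dis (Braid typeB n 1 0) n ≤ 4
  dis-s₁s₀s₁≤4 = dis-≤-one n 2 refl fixed
    where
    open ≡-Reasoning
    s₁-fixes : ∀ {j} → InWindow n j → j ≢ 1 → j ≢ 2 → s 1 (+ j) ≡ + j
    s₁-fixes j∈ j≢1 j≢2 = trans (s-window 0 _ j∈) (swapZ-other (j≢1 ∘ ℤₚ.+-injective) (j≢2 ∘ ℤₚ.+-injective))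
    fixed : ∀ j → InWindow n j → j ≢ 2 → Braid typeB n 1 0 (+ j) ≡ + j
    fixed j j∈ j≢2 = case j ℕ.≟ 1 of λ where
      (yes refl) → refl
      (no j≢1)   → begin
        s 1 (s 0 (s 1 (+ j)))  ≡⟨ cong (s 1 ∘ s 0) (s₁-fixes j∈ j≢1 j≢2) ⟩
        s 1 (s 0 (+ j))        ≡⟨ cong (s 1) (s₀-fixes j≢1) ⟩
        s 1 (+ j)              ≡⟨ s₁-fixes j∈ j≢1 j≢2 ⟩
        + j                    ∎

  bounds : GeneratorBounds typeB n
  bounds = record
    { gen-equivariant         = λ {i} _ → s-odd i
    ; gen-preservesWindowSums = s-preservesWindowSums
    ; dis-gen≤2               = dis-s≤2
    ; dis-braid≤4             = dis-braid≤4
    }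
    where
    dis-braid≤4 : ∀ {x y} → 1 ≤ x → x < n → (y ≡ suc x ⊎ suc y ≡ x) →
                  ValidLetter typeB n x → ValidLetter typeB n y → dis (Braid typeB n x y) n ≤ 4
    dis-braid≤4 {suc x} 1≤x _ (inj₁ refl) _ x+2<n =
      dis-braid-up (s (suc x)) (s (suc (suc x))) 1≤x x+2<n (s-window x) (s-window (suc x))
    dis-braid≤4 {_} {suc y} _ x<n (inj₂ refl) _ _ =
      dis-braid-down (s (suc (suc y))) (s (suc y)) (s≤s z≤n) x<n (s-window (suc y)) (s-window y)
    dis-braid≤4 {_} {zero} _ _ (inj₂ refl) _ _ = dis-s₁s₀s₁≤4

module TypeÃ (n : ℕ) (3≤n : 3 ≤ n) where

  private
    1≤n : 1 ≤ n
    1≤n = ℕₚ.≤-trans (s≤s z≤n) 3≤n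
    1<n : 1 < n
    1<n = ℕₚ.≤-trans (s≤s (s≤s z≤n)) 3≤n
    1∈ : InWindow n 1
    1∈ = ℕₚ.≤-refl , 1≤n
    n∈ : InWindow n n
    n∈ = 1≤n , ℕₚ.≤-refl
    n≡0 : + n ≡[mod n ] + 0
    n≡0 = mod-+M (+ 0)

  open SwapMod 1≤n

  s : ℕ → ℤ → ℤ
  s = gen typeÃ n

  s-window : ∀ {i} → 1 ≤ i → i < n → EqualOnWindow n (s i) (swapZ (+ i) (+ suc i))
  s-window 1≤i i<n j j∈ = swapMod-window 1≤i i<n j∈

  s-periodic : ∀ i j → s i (j ℤ.+ + n) ≡ s i j ℤ.+ + n
  s-periodic i = swapMod-+M (+ i) (+ 1)

  s-at-0 : ∀ i → s i (+ 0) ≡ s i (+ n) ℤ.- + n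
  s-at-0 i = begin
    s i (+ 0)                   ≡⟨ cancel (s i (+ 0)) (+ n) ⟨
    s i (+ 0) ℤ.+ + n ℤ.- + n   ≡⟨ cong (ℤ._- + n) (s-periodic i (+ 0)) ⟨
    s i (+ n) ℤ.- + n           ∎
    where
    open ≡-Reasoning
    cancel : ∀ x y → x ℤ.+ y ℤ.- y ≡ x
    cancel = solve-∀

  s₀-1 : s 0 (+ 1) ≡ + 0
  s₀-1 = swapMod-≡+ (+ 1) (λ 1≡0 → ℕₚ.<⇒≢ 1<n (window-unique 1∈ n∈ (mod-trans 1≡0 (mod-sym n≡0)))) mod-refl

  s₀-n : s 0 (+ n) ≡ + suc n
  s₀-n = trans (swapMod-≡ (+ 1) n≡0) (sym (+-suc n))

  s₀-fixes : ∀ {j} → InWindow n j → j ≢ 1 → j ≢ n → s 0 (+ j) ≡ + j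
  s₀-fixes j∈ j≢1 j≢n = swapMod-other (+ 1) (λ j≡0 → j≢n (window-unique j∈ n∈ (mod-trans j≡0 (mod-sym n≡0))))
                                      (j≢1 ∘ window-unique j∈ 1∈)

  s-preservesWindowSums : ∀ {i} → ValidLetter typeÃ n i → PreservesWindowSums typeÃ n (s i)
  s-preservesWindowSums {suc k} k<n F _ = windowSum-∘-swap F n (s≤s z≤n) (ℕₚ.n<1+n (suc k)) k<n (s-window (s≤s z≤n) k<n)
  s-preservesWindowSums {zero}  _   F F-per =
    trans (windowSum-cong n F∘s₀≗F∘swap) (windowSum-swap F n ℕₚ.≤-refl 1<n ℕₚ.≤-refl)
    where
    open ≡-Reasoning
    F∘s₀≗F∘swap : ∀ j → InWindow n j → F (s 0 (+ j)) ≡ F (swapZ (+ 1) (+ n) (+ j))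
    F∘s₀≗F∘swap j j∈ = cases (j ℕ.≟ 1) (j ℕ.≟ n)
      where
      cases : Dec (j ≡ 1) → Dec (j ≡ n) → F (s 0 (+ j)) ≡ F (swapZ (+ 1) (+ n) (+ j))
      cases (yes refl) _ = begin
        F (s 0 (+ 1))                ≡⟨ cong F s₀-1 ⟩
        F (+ 0)                      ≡⟨ F-per (+ 0) ⟨
        F (+ n)                      ≡⟨ cong F (swapZ-left (+ 1) (+ n)) ⟨
        F (swapZ (+ 1) (+ n) (+ 1))  ∎
      cases (no _) (yes refl) = begin
        F (s 0 (+ n))                ≡⟨ cong F s₀-n ⟩
        F (+ suc n)                  ≡⟨ F-per (+ 1) ⟩
        F (+ 1)                      ≡⟨ cong F (swapZ-right (ℕₚ.<⇒≢ 1<n ∘ ℤₚ.+-injective)) ⟨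
        F (swapZ (+ 1) (+ n) (+ n))  ∎
      cases (no j≢1) (no j≢n) = cong F (trans (s₀-fixes j∈ j≢1 j≢n)
                                         (sym (swapZ-other (j≢1 ∘ ℤₚ.+-injective) (j≢n ∘ ℤₚ.+-injective))))

  dis-s≤2 : ∀ {i} → ValidLetter typeÃ n i → dis (s i) n ≤ 2
  dis-s≤2 {suc k} k<n = dis-swap n 0 k<n (s≤s z≤n) (s-window (s≤s z≤n) k<n)
  dis-s≤2 {zero}  _   = begin
    dis (s 0) n                                 ≤⟨ dis-≤-two n (ℕₚ.<⇒≢ 1<n) s₀-1 s₀-n (λ j j∈ → s₀-fixes j∈) ⟩
    ∣ + 0 ℤ.- + 1 ∣ ℕ.+ ∣ + suc n ℤ.- + n ∣     ≡⟨ cong (1 ℕ.+_) (∣[k+a]-a∣≡k 1 n) ⟩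
    2                                           ∎
    where open ℕₚ.≤-Reasoning

  -- for x = n - 1 the braid s_x s₀ s_x exchanges x with n + 1 and 1 with -1
  dis-sₓs₀sₓ≤4 : ∀ {x} → 1 ≤ x → suc x ≡ n → dis (Braid typeÃ n x 0) n ≤ 4
  dis-sₓs₀sₓ≤4 {x} 1≤x x+1≡n =
    ℕₚ.≤-trans (dis-≤-two n x≢1 braid-x braid-1 fixed) (ℕₚ.≤-reflexive (cong (ℕ._+ 2) distance))
    where
    open ≡-Reasoning
    x<n : x < n
    x<n = ℕₚ.≤-reflexive x+1≡n
    x∈ : InWindow n x
    x∈ = 1≤x , ℕₚ.<⇒≤ x<n
    x≢1 : x ≢ 1
    x≢1 refl = ℕₚ.<⇒≢ (ℕₚ.≤-trans (ℕₚ.≤-reflexive (cong suc (sym x+1≡n))) 3≤n) refl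
    sₓ≗swap : EqualOnWindow n (s x) (swapZ (+ x) (+ n))
    sₓ≗swap j j∈ = subst (λ m → s x (+ j) ≡ swapZ (+ x) (+ m) (+ j)) x+1≡n (s-window 1≤x x<n j j∈)
    x≢n : + x ≢ + n
    x≢n = ℕₚ.<⇒≢ x<n ∘ ℤₚ.+-injective
    sₓ-n : s x (+ n) ≡ + x
    sₓ-n = trans (sₓ≗swap n n∈) (swapZ-right x≢n)
    sₓ-x : s x (+ x) ≡ + n
    sₓ-x = trans (sₓ≗swap x x∈) (swapZ-left (+ x) (+ n))
    sₓ-fixes : ∀ {j} → InWindow n j → j ≢ x → j ≢ n → s x (+ j) ≡ + j
    sₓ-fixes j∈ j≢x j≢n = trans (sₓ≗swap _ j∈) (swapZ-other (j≢x ∘ ℤₚ.+-injective) (j≢n ∘ ℤₚ.+-injective))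
    sₓ-1 : s x (+ 1) ≡ + 1
    sₓ-1 = sₓ-fixes 1∈ (x≢1 ∘ sym) (ℕₚ.<⇒≢ 1<n)
    braid-x : Braid typeÃ n x 0 (+ x) ≡ + suc n
    braid-x = begin
      s x (s 0 (s x (+ x)))  ≡⟨ cong (s x ∘ s 0) sₓ-x ⟩
      s x (s 0 (+ n))        ≡⟨ cong (s x) s₀-n ⟩
      s x (+ 1 ℤ.+ + n)      ≡⟨ s-periodic x (+ 1) ⟩
      s x (+ 1) ℤ.+ + n      ≡⟨ cong (ℤ._+ + n) sₓ-1 ⟩
      + suc n                ∎
    braid-1 : Braid typeÃ n x 0 (+ 1) ≡ -[1+ 0 ]
    braid-1 = begin
      s x (s 0 (s x (+ 1)))  ≡⟨ cong (s x ∘ s 0) sₓ-1 ⟩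
      s x (s 0 (+ 1))        ≡⟨ cong (s x) s₀-1 ⟩
      s x (+ 0)              ≡⟨ s-at-0 x ⟩
      s x (+ n) ℤ.- + n      ≡⟨ cong (ℤ._- + n) sₓ-n ⟩
      + x ℤ.- + n            ≡⟨ cong (λ m → + x ℤ.- + m) x+1≡n ⟨
      + x ℤ.- + suc x        ≡⟨ x-[1+x] x ⟩
      -[1+ 0 ]               ∎
      where
      x-[1+x] : ∀ x → + x ℤ.- + suc x ≡ -[1+ 0 ]
      x-[1+x] x = trans (cong (λ y → + x ℤ.- y) (+-suc x)) (lemma (+ x))
        where
        lemma : ∀ y → y ℤ.- (y ℤ.+ + 1) ≡ -[1+ 0 ]
        lemma = solve-∀
    fixed : ∀ j → InWindow n j → j ≢ x → j ≢ 1 → Braid typeÃ n x 0 (+ j) ≡ + j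
    fixed j j∈ j≢x j≢1 = case j ℕ.≟ n of λ where
      (yes refl) → begin
        s x (s 0 (s x (+ n)))  ≡⟨ cong (s x ∘ s 0) sₓ-n ⟩
        s x (s 0 (+ x))        ≡⟨ cong (s x) (s₀-fixes x∈ x≢1 (ℕₚ.<⇒≢ x<n)) ⟩
        s x (+ x)              ≡⟨ sₓ-x ⟩
        + n                    ∎
      (no j≢n) → begin
        s x (s 0 (s x (+ j)))  ≡⟨ cong (s x ∘ s 0) (sₓ-fixes j∈ j≢x j≢n) ⟩
        s x (s 0 (+ j))        ≡⟨ cong (s x) (s₀-fixes j∈ j≢1 j≢n) ⟩
        s x (+ j)              ≡⟨ sₓ-fixes j∈ j≢x j≢n ⟩
        + j                    ∎
    distance : ∣ + suc n ℤ.- + x ∣ ≡ 2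
    distance rewrite sym x+1≡n = ∣[k+a]-a∣≡k 2 x

  -- s₁ s₀ s₁ exchanges 2 with 0 and n with n + 2
  dis-s₁s₀s₁≤4 : dis (Braid typeÃ n 1 0) n ≤ 4
  dis-s₁s₀s₁≤4 =
    ℕₚ.≤-trans (dis-≤-two n 2≢n braid-2 braid-n fixed) (ℕₚ.≤-reflexive (cong (2 ℕ.+_) (∣[k+a]-a∣≡k 2 n)))
    where
    open ≡-Reasoning
    2≢n : 2 ≢ n
    2≢n = ℕₚ.<⇒≢ 3≤n
    2∈ : InWindow n 2
    2∈ = s≤s z≤n , ℕₚ.<⇒≤ 3≤n
    s₁≗swap : EqualOnWindow n (s 1) (swapZ (+ 1) (+ 2))
    s₁≗swap = s-window ℕₚ.≤-refl 1<n
    s₁-fixes : ∀ {j} → InWindow n j → j ≢ 1 → j ≢ 2 → s 1 (+ j) ≡ + j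
    s₁-fixes j∈ j≢1 j≢2 = trans (s₁≗swap _ j∈) (swapZ-other (j≢1 ∘ ℤₚ.+-injective) (j≢2 ∘ ℤₚ.+-injective))
    s₁-1 : s 1 (+ 1) ≡ + 2
    s₁-1 = trans (s₁≗swap 1 1∈) (swapZ-left (+ 1) (+ 2))
    s₁-2 : s 1 (+ 2) ≡ + 1
    s₁-2 = trans (s₁≗swap 2 2∈) (swapZ-right {+ 1} {+ 2} (λ ()))
    s₁-n : s 1 (+ n) ≡ + n
    s₁-n = s₁-fixes n∈ (ℕₚ.<⇒≢ 1<n ∘ sym) (2≢n ∘ sym)
    braid-2 : Braid typeÃ n 1 0 (+ 2) ≡ + 0
    braid-2 = begin
      s 1 (s 0 (s 1 (+ 2)))  ≡⟨ cong (s 1 ∘ s 0) s₁-2 ⟩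
      s 1 (s 0 (+ 1))        ≡⟨ cong (s 1) s₀-1 ⟩
      s 1 (+ 0)              ≡⟨ s-at-0 1 ⟩
      s 1 (+ n) ℤ.- + n      ≡⟨ cong (ℤ._- + n) s₁-n ⟩
      + n ℤ.- + n            ≡⟨ ℤₚ.+-inverseʳ (+ n) ⟩
      + 0                    ∎
    braid-n : Braid typeÃ n 1 0 (+ n) ≡ + (2 ℕ.+ n)
    braid-n = begin
      s 1 (s 0 (s 1 (+ n)))  ≡⟨ cong (s 1 ∘ s 0) s₁-n ⟩
      s 1 (s 0 (+ n))        ≡⟨ cong (s 1) s₀-n ⟩
      s 1 (+ 1 ℤ.+ + n)      ≡⟨ s-periodic 1 (+ 1) ⟩
      s 1 (+ 1) ℤ.+ + n      ≡⟨ cong (ℤ._+ + n) s₁-1 ⟩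
      + (2 ℕ.+ n)            ∎
    fixed : ∀ j → InWindow n j → j ≢ 2 → j ≢ n → Braid typeÃ n 1 0 (+ j) ≡ + j
    fixed j j∈ j≢2 j≢n = case j ℕ.≟ 1 of λ where
      (yes refl) → begin
        s 1 (s 0 (s 1 (+ 1)))  ≡⟨ cong (s 1 ∘ s 0) s₁-1 ⟩
        s 1 (s 0 (+ 2))        ≡⟨ cong (s 1) (s₀-fixes 2∈ (λ ()) 2≢n) ⟩
        s 1 (+ 2)              ≡⟨ s₁-2 ⟩
        + 1                    ∎
      (no j≢1) → begin
        s 1 (s 0 (s 1 (+ j)))  ≡⟨ cong (s 1 ∘ s 0) (s₁-fixes j∈ j≢1 j≢2) ⟩
        s 1 (s 0 (+ j))        ≡⟨ cong (s 1) (s₀-fixes j∈ j≢1 j≢n) ⟩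
        s 1 (+ j)              ≡⟨ s₁-fixes j∈ j≢1 j≢2 ⟩
        + j                    ∎

  bounds : GeneratorBounds typeÃ n
  bounds = record
    { gen-equivariant         = λ {i} _ → s-periodic i
    ; gen-preservesWindowSums = s-preservesWindowSums
    ; dis-gen≤2               = dis-s≤2
    ; dis-braid≤4             = dis-braid≤4
    }
    where
    dis-braid≤4 : ∀ {x y} → 1 ≤ x → x < n → (y ≡ nextLetter typeÃ n x ⊎ suc y ≡ x) →
                  ValidLetter typeÃ n x → ValidLetter typeÃ n y → dis (Braid typeÃ n x y) n ≤ 4
    dis-braid≤4 {x} 1≤x x<n (inj₁ refl) _ vy with suc x ℕ.≡ᵇ n in x+1≡ᵇn
    ... | true  = dis-sₓs₀sₓ≤4 1≤x (≡ᵇ-true⇒≡ x+1≡ᵇn)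
    ... | false = dis-braid-up (s x) (s (suc x)) 1≤x vy (s-window 1≤x x<n) (s-window (s≤s z≤n) vy)
    dis-braid≤4 {_} {suc y} _ x<n (inj₂ refl) _ vy =
      dis-braid-down (s (suc (suc y))) (s (suc y)) (s≤s z≤n) x<n (s-window (s≤s z≤n) x<n) (s-window (s≤s z≤n) vy)
    dis-braid≤4 {_} {zero}  _ _   (inj₂ refl) _ _  = dis-s₁s₀s₁≤4

module TypeC̃ (n : ℕ) (2≤n : 2 ≤ n) where

  M : ℕ
  M = 2 ℕ.* n ℕ.+ 2

  private
    1≤n : 1 ≤ n
    1≤n = ℕₚ.<⇒≤ 2≤n
    1∈ : InWindow n 1
    1∈ = ℕₚ.≤-refl , 1≤n
    n∈ : InWindow n n
    n∈ = 1≤n , ℕₚ.≤-refl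
    2n<M : 2 ℕ.* n < M
    2n<M = ℕₚ.m<m+n (2 ℕ.* n) {2} (s≤s z≤n)
    1≤M : 1 ≤ M
    1≤M = ℕₚ.≤-trans (s≤s z≤n) (ℕₚ.m≤n+m 2 (2 ℕ.* n))
    n+2≤M : n ℕ.+ 2 ≤ M
    n+2≤M = ℕₚ.+-monoˡ-≤ 2 (ℕₚ.m≤n*m n 2)
    sum<M : ∀ {a b} → a ≤ n → b ≤ n → a ℕ.+ b < M
    sum<M {a} {b} a≤n b≤n = ℕₚ.≤-<-trans (ℕₚ.≤-trans (ℕₚ.+-mono-≤ a≤n b≤n) n+n≤2n) 2n<M
      where
      n+n≤2n : n ℕ.+ n ≤ 2 ℕ.* n
      n+n≤2n = ℕₚ.≤-reflexive (cong (n ℕ.+_) (sym (ℕₚ.+-identityʳ n)))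
    n<M : n < M
    n<M = ℕₚ.≤-<-trans (ℕₚ.m≤m+n n n) (sum<M ℕₚ.≤-refl ℕₚ.≤-refl)
    inWindow-M : ∀ {j} → InWindow n j → InWindow M j
    inWindow-M (1≤j , j≤n) = 1≤j , ℕₚ.≤-trans j≤n (ℕₚ.<⇒≤ n<M)
    small≢0 : ∀ {k} → 1 ≤ k → k < M → ¬ + k ≡[mod M ] + 0
    small≢0 {suc k} _ k<M k≡0 with mod-unique (subst (_< M) (sym (ℕₚ.+-identityʳ (suc k))) k<M) k≡0
    ... | ()
    1≢0 : ¬ + 1 ≡[mod M ] + 0
    1≢0 = small≢0 ℕₚ.≤-refl (ℕₚ.≤-<-trans 1≤n n<M)
    2≢0 : ¬ + 2 ≡[mod M ] + 0
    2≢0 = small≢0 (s≤s z≤n) (ℕₚ.≤-<-trans 2≤n n<M)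

  open SwapMod 1≤M

  pos≢neg : ∀ {p q} → 1 ≤ p → p ℕ.+ q < M → ¬ + p ≡[mod M ] ℤ.- + q
  pos≢neg {suc p} {q} _ p+q<M p≡-q = pos≢nonpos q (mod-unique (subst (_< M) (sym distance) p+q<M) p≡-q)
    where
    distance : ∣ + suc p ℤ.- ℤ.- + q ∣ ≡ suc p ℕ.+ q
    distance = cong ∣_∣ (trans (cong (λ x → + suc p ℤ.+ x) (ℤₚ.neg-involutive (+ q))) (sym (ℤₚ.pos-+ (suc p) q)))
    pos≢nonpos : ∀ q → + suc p ≢ ℤ.- + q
    pos≢nonpos zero    ()
    pos≢nonpos (suc q) ()

  s : ℕ → ℤ → ℤ
  s = gen typeC̃ n

  sₙ≡swapMod : ∀ j → s n j ≡ swapMod M (+ n) (+ 2) j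
  sₙ≡swapMod j with n ℕ.≡ᵇ 0 in n≡ᵇ0 | n ℕ.≡ᵇ n in n≡ᵇn
  ... | true  | _     = ⊥-elim (ℕₚ.<⇒≢ 1≤n (sym (≡ᵇ-true⇒≡ n≡ᵇ0)))
  ... | false | true  = refl
  ... | false | false = ⊥-elim (subst T n≡ᵇn (ℕₚ.≡⇒≡ᵇ n n refl))

  mid : ℕ → ℤ → ℤ
  mid i = swapMod M (+ i) (+ 1) ∘ swapMod M (ℤ.- + suc i) (+ 1)

  s≡mid : ∀ {i} → 1 ≤ i → i < n → ∀ j → s i j ≡ mid i j
  s≡mid {suc k} _ k<n j with suc k ℕ.≡ᵇ n in k+1≡ᵇn
  ... | true  = ⊥-elim (ℕₚ.<⇒≢ k<n (≡ᵇ-true⇒≡ k+1≡ᵇn))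
  ... | false = refl

  +M≡2n+2 : + M ≡ + 2 ℤ.* + n ℤ.+ + 2
  +M≡2n+2 = trans (ℤₚ.pos-+ (2 ℕ.* n) 2) (cong (ℤ._+ + 2) (ℤₚ.pos-* 2 n))

  private
    -[1+i]+1≡-i : ∀ i → ℤ.- + suc i ℤ.+ + 1 ≡ ℤ.- + i
    -[1+i]+1≡-i i = trans (cong (λ x → ℤ.- x ℤ.+ + 1) (+-suc i)) (cancel (+ i))
      where
      cancel : ∀ x → ℤ.- (x ℤ.+ + 1) ℤ.+ + 1 ≡ ℤ.- x
      cancel = solve-∀
    -[n+2]≡n : ℤ.- (+ n ℤ.+ + 2) ≡[mod M ] + n
    -[n+2]≡n = mod-sym (mod (divides (+ 1) (trans (difference (+ n)) (cong (+ 1 ℤ.*_) (sym +M≡2n+2)))))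
      where
      difference : ∀ x → x ℤ.- ℤ.- (x ℤ.+ + 2) ≡ + 1 ℤ.* (+ 2 ℤ.* x ℤ.+ + 2)
      difference = solve-∀

  mid-odd : ∀ {i} → 1 ≤ i → i < n → ∀ j → mid i (ℤ.- j) ≡ ℤ.- mid i j
  mid-odd {i} 1≤i i<n j = begin
    S (S′ (ℤ.- j))                     ≡⟨ cong S (swapMod-neg C 1≢0 j) ⟩
    S (ℤ.- swapMod M (ℤ.- (C ℤ.+ + 1)) (+ 1) j)
                                       ≡⟨ cong (λ x → S (ℤ.- x)) (swapMod-cong (+ 1) j (mod-reflexive -[C+1]≡i)) ⟩
    S (ℤ.- S j)                        ≡⟨ swapMod-neg (+ i) 1≢0 (S j) ⟩
    ℤ.- swapMod M (ℤ.- (+ i ℤ.+ + 1)) (+ 1) (S j)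
                                       ≡⟨ cong ℤ.-_ (swapMod-cong (+ 1) (S j) (mod-reflexive -[i+1]≡C)) ⟩
    ℤ.- S′ (S j)                       ≡⟨ cong ℤ.-_ (swapMod-comm C≢i C≢i+1 C+1≢i C+1≢i+1 j) ⟩
    ℤ.- S (S′ j)                       ∎
    where
    open ≡-Reasoning
    C : ℤ
    C = ℤ.- + suc i
    S S′ : ℤ → ℤ
    S = swapMod M (+ i) (+ 1)
    S′ = swapMod M C (+ 1)
    -[C+1]≡i : ℤ.- (C ℤ.+ + 1) ≡ + i
    -[C+1]≡i = trans (cong ℤ.-_ (-[1+i]+1≡-i i)) (ℤₚ.neg-involutive (+ i))
    -[i+1]≡C : ℤ.- (+ i ℤ.+ + 1) ≡ C
    -[i+1]≡C = cong ℤ.-_ (sym (+-suc i))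
    i≤n : i ≤ n
    i≤n = ℕₚ.<⇒≤ i<n
    C≢i : ¬ C ≡[mod M ] + i
    C≢i = pos≢neg 1≤i (sum<M i≤n i<n) ∘ mod-sym
    C≢i+1 : ¬ C ≡[mod M ] + i ℤ.+ + 1
    C≢i+1 = pos≢neg (s≤s z≤n) (sum<M i<n i<n) ∘ subst (_≡[mod M ] C) (sym (+-suc i)) ∘ mod-sym
    C+1≢i : ¬ C ℤ.+ + 1 ≡[mod M ] + i
    C+1≢i = pos≢neg 1≤i (sum<M i≤n i≤n) ∘ subst (+ i ≡[mod M ]_) (-[1+i]+1≡-i i) ∘ mod-sym
    C+1≢i+1 : ¬ C ℤ.+ + 1 ≡[mod M ] + i ℤ.+ + 1
    C+1≢i+1 = pos≢neg (s≤s z≤n) (sum<M i<n i≤n) ∘ subst₂ _≡[mod M ]_ (sym (+-suc i)) (-[1+i]+1≡-i i) ∘ mod-sym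

  data Letter : ℕ → Set where
    zero-letter   : Letter 0
    last-letter   : Letter n
    middle-letter : ∀ {i} → 1 ≤ i → i < n → Letter i

  classify : ∀ {i} → i ≤ n → Letter i
  classify {zero}  _   = zero-letter
  classify {suc k} k<n with ℕₚ.m≤n⇒m<n∨m≡n k<n
  ... | inj₁ k+1<n = middle-letter (s≤s z≤n) k+1<n
  ... | inj₂ k+1≡n = subst Letter (sym k+1≡n) last-letter

  s-equivariant : ∀ {i} → ValidLetter typeC̃ n i → Equivariant typeC̃ n (s i)
  s-equivariant i≤n with classify i≤n
  ... | zero-letter = swapMod-neg (ℤ.- + 1) 2≢0 , swapMod-+M (ℤ.- + 1) (+ 2)
  ... | last-letter = sₙ-odd , sₙ-periodic
    where
    sₙ-odd : ∀ j → s n (ℤ.- j) ≡ ℤ.- s n j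
    sₙ-odd j = begin
      s n (ℤ.- j)                                   ≡⟨ sₙ≡swapMod (ℤ.- j) ⟩
      swapMod M (+ n) (+ 2) (ℤ.- j)                 ≡⟨ swapMod-neg (+ n) 2≢0 j ⟩
      ℤ.- swapMod M (ℤ.- (+ n ℤ.+ + 2)) (+ 2) j     ≡⟨ cong ℤ.-_ (swapMod-cong (+ 2) j -[n+2]≡n) ⟩
      ℤ.- swapMod M (+ n) (+ 2) j                   ≡⟨ cong ℤ.-_ (sₙ≡swapMod j) ⟨
      ℤ.- s n j                                     ∎
      where open ≡-Reasoning
    sₙ-periodic : ∀ j → s n (j ℤ.+ + M) ≡ s n j ℤ.+ + M
    sₙ-periodic j = trans (sₙ≡swapMod _) (trans (swapMod-+M (+ n) (+ 2) j) (cong (ℤ._+ + M) (sym (sₙ≡swapMod j))))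
  ... | middle-letter {i} 1≤i i<n = sᵢ-odd , sᵢ-periodic
    where
    sᵢ-odd : ∀ j → s i (ℤ.- j) ≡ ℤ.- s i j
    sᵢ-odd j = trans (s≡mid 1≤i i<n _) (trans (mid-odd 1≤i i<n j) (cong ℤ.-_ (sym (s≡mid 1≤i i<n j))))
    sᵢ-periodic : ∀ j → s i (j ℤ.+ + M) ≡ s i j ℤ.+ + M
    sᵢ-periodic j = begin
      s i (j ℤ.+ + M)                     ≡⟨ s≡mid 1≤i i<n _ ⟩
      mid i (j ℤ.+ + M)                   ≡⟨ cong (swapMod M (+ i) (+ 1)) (swapMod-+M (ℤ.- + suc i) (+ 1) j) ⟩
      swapMod M (+ i) (+ 1) (swapMod M (ℤ.- + suc i) (+ 1) j ℤ.+ + M)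
                                          ≡⟨ swapMod-+M (+ i) (+ 1) _ ⟩
      mid i j ℤ.+ + M                     ≡⟨ cong (ℤ._+ + M) (s≡mid 1≤i i<n j) ⟨
      s i j ℤ.+ + M                       ∎
      where open ≡-Reasoning

  s-window : ∀ {i} → 1 ≤ i → i < n → EqualOnWindow n (s i) (swapZ (+ i) (+ suc i))
  s-window {i} 1≤i i<n j j∈@(1≤j , j≤n) = begin
    s i (+ j)                                   ≡⟨ s≡mid 1≤i i<n (+ j) ⟩
    swapMod M (+ i) (+ 1) (swapMod M (ℤ.- + suc i) (+ 1) (+ j))
                                                ≡⟨ cong (swapMod M (+ i) (+ 1)) (swapMod-other (+ 1) j≢C j≢C+1) ⟩
    swapMod M (+ i) (+ 1) (+ j)                 ≡⟨ swapMod-window 1≤i (ℕₚ.<-trans i<n n<M) (inWindow-M j∈) ⟩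
    swapZ (+ i) (+ suc i) (+ j)                 ∎
    where
    open ≡-Reasoning
    j≢C : ¬ + j ≡[mod M ] ℤ.- + suc i
    j≢C = pos≢neg 1≤j (sum<M j≤n i<n)
    j≢C+1 : ¬ + j ≡[mod M ] ℤ.- + suc i ℤ.+ + 1
    j≢C+1 = pos≢neg 1≤j (sum<M j≤n (ℕₚ.<⇒≤ i<n)) ∘ subst (+ j ≡[mod M ]_) (-[1+i]+1≡-i i)

  s₀-1 : s 0 (+ 1) ≡ ℤ.- + 1
  s₀-1 = swapMod-≡+ (+ 2) (pos≢neg ℕₚ.≤-refl (sum<M 1≤n 1≤n)) mod-refl

  s₀-fixes : ∀ {j} → InWindow n j → j ≢ 1 → s 0 (+ j) ≡ + j
  s₀-fixes j∈@(1≤j , j≤n) j≢1 =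
    swapMod-other (+ 2) (pos≢neg 1≤j (sum<M j≤n 1≤n)) (j≢1 ∘ window-unique (inWindow-M j∈) (inWindow-M 1∈))

  sₙ-n : s n (+ n) ≡ + n ℤ.+ + 2
  sₙ-n = trans (sₙ≡swapMod (+ n)) (swapMod-≡ (+ 2) mod-refl)

  sₙ-fixes : ∀ {j} → InWindow n j → j ≢ n → s n (+ j) ≡ + j
  sₙ-fixes {j} j∈@(1≤j , j≤n) j≢n = trans (sₙ≡swapMod (+ j)) (swapMod-other (+ 2)
    (j≢n ∘ window-unique (inWindow-M j∈) (inWindow-M n∈))
    (j≢n+2 ∘ window-unique (inWindow-M j∈) (ℕₚ.≤-trans 1≤n (ℕₚ.m≤m+n n 2) , n+2≤M)
           ∘ subst (+ j ≡[mod M ]_) (sym (ℤₚ.pos-+ n 2))))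
    where
    j≢n+2 : j ≢ n ℕ.+ 2
    j≢n+2 = ℕₚ.<⇒≢ (ℕₚ.≤-<-trans j≤n (ℕₚ.m<m+n n {2} (s≤s z≤n)))

  n+2≡-n+M : + n ℤ.+ + 2 ≡ ℤ.- + n ℤ.+ + M
  n+2≡-n+M = trans (rearrange (+ n)) (cong (λ x → ℤ.- + n ℤ.+ x) (sym +M≡2n+2))
    where
    rearrange : ∀ x → x ℤ.+ + 2 ≡ ℤ.- x ℤ.+ (+ 2 ℤ.* x ℤ.+ + 2)
    rearrange = solve-∀

  s-preservesWindowSums : ∀ {i} → ValidLetter typeC̃ n i → PreservesWindowSums typeC̃ n (s i)
  s-preservesWindowSums i≤n F (F-even , F-per) with classify i≤n
  ... | zero-letter = windowSum-cong n F∘s₀≗F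
    where
    F∘s₀≗F : ∀ j → InWindow n j → F (s 0 (+ j)) ≡ F (+ j)
    F∘s₀≗F j j∈ = case j ℕ.≟ 1 of λ where
      (yes refl) → trans (cong F s₀-1) (F-even (+ 1))
      (no j≢1)   → cong F (s₀-fixes j∈ j≢1)
  ... | last-letter = windowSum-cong n F∘sₙ≗F
    where
    open ≡-Reasoning
    F∘sₙ≗F : ∀ j → InWindow n j → F (s n (+ j)) ≡ F (+ j)
    F∘sₙ≗F j j∈ = case j ℕ.≟ n of λ where
      (yes refl) → begin
        F (s j (+ j))              ≡⟨ cong F sₙ-n ⟩
        F (+ j ℤ.+ + 2)            ≡⟨ cong F n+2≡-n+M ⟩
        F (ℤ.- + j ℤ.+ + M)        ≡⟨ F-per (ℤ.- + j) ⟩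
        F (ℤ.- + j)                ≡⟨ F-even (+ j) ⟩
        F (+ j)                    ∎
      (no j≢n) → cong F (sₙ-fixes j∈ j≢n)
  ... | middle-letter {i} 1≤i i<n = windowSum-∘-swap F n 1≤i (ℕₚ.n<1+n i) i<n (s-window 1≤i i<n)

  dis-s≤2 : ∀ {i} → ValidLetter typeC̃ n i → dis (s i) n ≤ 2
  dis-s≤2 i≤n with classify i≤n
  ... | zero-letter = dis-≤-one n 1 s₀-1 (λ j j∈ → s₀-fixes j∈)
  ... | last-letter = ℕₚ.≤-trans (dis-≤-one n n sₙ-n (λ j j∈ → sₙ-fixes j∈))
                                 (ℕₚ.≤-reflexive (trans (cong (λ x → ∣ x ℤ.- + n ∣) (sym (ℤₚ.pos-+ n 2)))
                                                        (trans (cong (λ x → ∣ + x ℤ.- + n ∣) (ℕₚ.+-comm n 2))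
                                                               (∣[k+a]-a∣≡k 2 n))))
  ... | middle-letter 1≤i i<n = dis-swap n 0 i<n 1≤i (s-window 1≤i i<n)

  -- for x = n - 1 the braid s_x sₙ s_x sends x to M - x and fixes the rest of the window
  dis-sₓsₙsₓ≤4 : ∀ {x} → 1 ≤ x → suc x ≡ n → dis (Braid typeC̃ n x n) n ≤ 4
  dis-sₓsₙsₓ≤4 {x} 1≤x x+1≡n =
    ℕₚ.≤-trans (dis-≤-one n x braid-x fixed) (ℕₚ.≤-reflexive distance)
    where
    open ≡-Reasoning
    x<n : x < n
    x<n = ℕₚ.≤-reflexive x+1≡n
    x∈ : InWindow n x
    x∈ = 1≤x , ℕₚ.<⇒≤ x<n
    sₓ≗swap : EqualOnWindow n (s x) (swapZ (+ x) (+ n))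
    sₓ≗swap j j∈ = subst (λ m → s x (+ j) ≡ swapZ (+ x) (+ m) (+ j)) x+1≡n (s-window 1≤x x<n j j∈)
    sₓ-n : s x (+ n) ≡ + x
    sₓ-n = trans (sₓ≗swap n n∈) (swapZ-right (ℕₚ.<⇒≢ x<n ∘ ℤₚ.+-injective))
    sₓ-x : s x (+ x) ≡ + n
    sₓ-x = trans (sₓ≗swap x x∈) (swapZ-left (+ x) (+ n))
    sₓ-fixes : ∀ {j} → InWindow n j → j ≢ x → j ≢ n → s x (+ j) ≡ + j
    sₓ-fixes j∈ j≢x j≢n = trans (sₓ≗swap _ j∈) (swapZ-other (j≢x ∘ ℤₚ.+-injective) (j≢n ∘ ℤₚ.+-injective))
    sₓ-equivariant : Equivariant typeC̃ n (s x)
    sₓ-equivariant = s-equivariant (ℕₚ.<⇒≤ x<n)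
    braid-x : Braid typeC̃ n x n (+ x) ≡ ℤ.- + x ℤ.+ + M
    braid-x = begin
      s x (s n (s x (+ x)))      ≡⟨ cong (s x ∘ s n) sₓ-x ⟩
      s x (s n (+ n))            ≡⟨ cong (s x) (trans sₙ-n n+2≡-n+M) ⟩
      s x (ℤ.- + n ℤ.+ + M)      ≡⟨ proj₂ sₓ-equivariant (ℤ.- + n) ⟩
      s x (ℤ.- + n) ℤ.+ + M      ≡⟨ cong (ℤ._+ + M) (proj₁ sₓ-equivariant (+ n)) ⟩
      ℤ.- s x (+ n) ℤ.+ + M      ≡⟨ cong (λ y → ℤ.- y ℤ.+ + M) sₓ-n ⟩
      ℤ.- + x ℤ.+ + M            ∎
    fixed : ∀ j → InWindow n j → j ≢ x → Braid typeC̃ n x n (+ j) ≡ + j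
    fixed j j∈ j≢x = case j ℕ.≟ n of λ where
      (yes refl) → begin
        s x (s j (s x (+ j)))  ≡⟨ cong (s x ∘ s j) sₓ-n ⟩
        s x (s j (+ x))        ≡⟨ cong (s x) (sₙ-fixes x∈ (ℕₚ.<⇒≢ x<n)) ⟩
        s x (+ x)              ≡⟨ sₓ-x ⟩
        + j                    ∎
      (no j≢n) → begin
        s x (s n (s x (+ j)))  ≡⟨ cong (s x ∘ s n) (sₓ-fixes j∈ j≢x j≢n) ⟩
        s x (s n (+ j))        ≡⟨ cong (s x) (sₙ-fixes j∈ j≢n) ⟩
        s x (+ j)              ≡⟨ sₓ-fixes j∈ j≢x j≢n ⟩
        + j                    ∎
    distance : ∣ ℤ.- + x ℤ.+ + M ℤ.- + x ∣ ≡ 4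
    distance rewrite +M≡2n+2 | sym x+1≡n = cong ∣_∣ (trans
      (cong (λ y → ℤ.- + x ℤ.+ (+ 2 ℤ.* y ℤ.+ + 2) ℤ.- + x) (+-suc x)) (cancel (+ x)))
      where
      cancel : ∀ y → ℤ.- y ℤ.+ (+ 2 ℤ.* (y ℤ.+ + 1) ℤ.+ + 2) ℤ.- y ≡ + 4
      cancel = solve-∀

  dis-s₁s₀s₁≤4 : dis (Braid typeC̃ n 1 0) n ≤ 4
  dis-s₁s₀s₁≤4 = dis-≤-one n 2 braid-2 fixed
    where
    open ≡-Reasoning
    2∈ : InWindow n 2
    2∈ = s≤s z≤n , 2≤n
    s₁≗swap : EqualOnWindow n (s 1) (swapZ (+ 1) (+ 2))
    s₁≗swap = s-window ℕₚ.≤-refl 2≤n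
    s₁-1 : s 1 (+ 1) ≡ + 2
    s₁-1 = trans (s₁≗swap 1 1∈) (swapZ-left (+ 1) (+ 2))
    s₁-2 : s 1 (+ 2) ≡ + 1
    s₁-2 = trans (s₁≗swap 2 2∈) (swapZ-right {+ 1} {+ 2} (λ ()))
    s₁-fixes : ∀ {j} → InWindow n j → j ≢ 1 → j ≢ 2 → s 1 (+ j) ≡ + j
    s₁-fixes j∈ j≢1 j≢2 = trans (s₁≗swap _ j∈) (swapZ-other (j≢1 ∘ ℤₚ.+-injective) (j≢2 ∘ ℤₚ.+-injective))
    braid-2 : Braid typeC̃ n 1 0 (+ 2) ≡ ℤ.- + 2
    braid-2 = begin
      s 1 (s 0 (s 1 (+ 2)))  ≡⟨ cong (s 1 ∘ s 0) s₁-2 ⟩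
      s 1 (s 0 (+ 1))        ≡⟨ cong (s 1) s₀-1 ⟩
      s 1 (ℤ.- + 1)          ≡⟨ proj₁ (s-equivariant 1≤n) (+ 1) ⟩
      ℤ.- s 1 (+ 1)          ≡⟨ cong ℤ.-_ s₁-1 ⟩
      ℤ.- + 2                ∎
    fixed : ∀ j → InWindow n j → j ≢ 2 → Braid typeC̃ n 1 0 (+ j) ≡ + j
    fixed j j∈ j≢2 = case j ℕ.≟ 1 of λ where
      (yes refl) → begin
        s 1 (s 0 (s 1 (+ 1)))  ≡⟨ cong (s 1 ∘ s 0) s₁-1 ⟩
        s 1 (s 0 (+ 2))        ≡⟨ cong (s 1) (s₀-fixes 2∈ (λ ())) ⟩
        s 1 (+ 2)              ≡⟨ s₁-2 ⟩
        + 1                    ∎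
      (no j≢1) → begin
        s 1 (s 0 (s 1 (+ j)))  ≡⟨ cong (s 1 ∘ s 0) (s₁-fixes j∈ j≢1 j≢2) ⟩
        s 1 (s 0 (+ j))        ≡⟨ cong (s 1) (s₀-fixes j∈ j≢1) ⟩
        s 1 (+ j)              ≡⟨ s₁-fixes j∈ j≢1 j≢2 ⟩
        + j                    ∎

  bounds : GeneratorBounds typeC̃ n
  bounds = record
    { gen-equivariant         = s-equivariant
    ; gen-preservesWindowSums = s-preservesWindowSums
    ; dis-gen≤2               = dis-s≤2
    ; dis-braid≤4             = dis-braid≤4
    }
    where
    dis-braid≤4 : ∀ {x y} → 1 ≤ x → x < n → (y ≡ suc x ⊎ suc y ≡ x) →
                  ValidLetter typeC̃ n x → ValidLetter typeC̃ n y → dis (Braid typeC̃ n x y) n ≤ 4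
    dis-braid≤4 {x} 1≤x x<n (inj₁ refl) _ x+1≤n with ℕₚ.m≤n⇒m<n∨m≡n x+1≤n
    ... | inj₁ x+1<n = dis-braid-up (s x) (s (suc x)) 1≤x x+1<n (s-window 1≤x x<n) (s-window (s≤s z≤n) x+1<n)
    ... | inj₂ x+1≡n = subst (λ y → dis (Braid typeC̃ n x y) n ≤ 4) (sym x+1≡n) (dis-sₓsₙsₓ≤4 1≤x x+1≡n)
    dis-braid≤4 {_} {suc y} _ x<n (inj₂ refl) _ y+1≤n =
      dis-braid-down (s (suc (suc y))) (s (suc y)) (s≤s z≤n) x<n (s-window (s≤s z≤n) x<n)
                     (s-window (s≤s z≤n) (ℕₚ.<-trans (ℕₚ.n<1+n (suc y)) x<n))
    dis-braid≤4 {_} {zero} _ _ (inj₂ refl) _ _ = dis-s₁s₀s₁≤4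

bounds : ∀ T n → minRank T ≤ n → GeneratorBounds T n
bounds typeA n _   = TypeA.bounds n
bounds typeB n _   = TypeB.bounds n
bounds typeÃ n 3≤n = TypeÃ.bounds n 3≤n
bounds typeC̃ n 2≤n = TypeC̃.bounds n 2≤n

theorem3p4 : (T : GroupType) (n : ℕ) → minRank T ≤ n →
    (u : Word) → ValidWord T n u → Reduced T n u → HasTriple T n u →
    dis (eval T n u) n < 2 * length u
theorem3p4 T n n≥rank u valid _ (p , q , x , y , 1≤x , x<n , y-adj , refl) =
  WordBounds.dis-eval-braid< (bounds T n n≥rank) p q valid 1≤x x<n y-adj
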